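{- Let $\mathcal A\in\mathsf{Struc}_{c_1,c_2}$ and consider the properties: (a) $\mathcal A$ contains ${\rm id}_{U_{\mathcal A}}$ (as one of its relations); (b) ${\rm id}_{U_{\mathcal A}}\in{\rm DEC}_{\mathcal A}$; (c) ${\rm id}_{U_{\mathcal A}}\in{\rm SDEC}_{\mathcal A}$; (d) $\{c_1\}\in{\rm SDEC}_{\mathcal A}$ and $\{c_2\}\in{\rm SDEC}_{\mathcal A}$; (e) $\{c_1,c_2\}^\infty\in{\rm SDEC}_{\mathcal A}$. Then (a) implies (b), (b) implies (c), (c) implies (d), and (d) implies (e).
   Context: A first-order structure $\mathcal A=(U_{\mathcal A};(c_i)_{i\in N_1};(f_i)_{i\in N_2};(r_i)_{i\in N_3})$ of finite signature consists of a universe, constants, operations and relations. ${\rm id}_{U_{\mathcal A}}=\{(x,x)\mid x\in U_{\mathcal A}\}\subseteq U_{\mathcal A}^2$. $U_{\mathcal A}^\infty=\bigcup_{n\ge 1}U_{\mathcal A}^n$ and $\{c_1,c_2\}^\infty=\bigcup_{n\ge1}\{c_1,c_2\}^n$. $\mathsf{Struc}_{c_1,c_2}$ is the class of structures having two distinct elements $c_1\neq c_2$ among their constants. A (deterministic) BSS RAM over $\mathcal A$ (class $\mathsf M_{\mathcal A}$) has registers $Z_1,Z_2,\dots$ for elements of $U_{\mathcal A}$, finitely many index registers $I_1,\dots,I_k$ for positive integers, and a finite program of labeled instructions ending with stop; instructions: $Z_j:=f_i(Z_{j_1},\dots,Z_{j_m})$, $Z_j:=c_i$, $Z_j:=Z_k$,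 $Z_{I_j}:=Z_{I_k}$, $I_j:=1$, $I_j:=I_j+1$, "if $r_i(Z_{j_1},\dots,Z_{j_k})$ then goto $\ell_1$ else goto $\ell_2$", "if $I_j=I_k$ then goto $\ell_1$ else goto $\ell_2$", stop, using only the constants, operations and relations of $\mathcal A$ (equality of elements of $U_{\mathcal A}$ can be tested directly only if the identity is a relation of $\mathcal A$). On input $(x_1,\dots,x_n)$: start at label 1 with $Z_i=x_i$ ($i\le n$), $Z_i=x_n$ ($i>n$), $I_1=n$, other index registers $1$. $H_{\mathcal M}$ = set of inputs on which $\mathcal M$ reaches stop; ${\rm SDEC}_{\mathcal A}=\{H_{\mathcal M}\mid\mathcal M\in\mathsf M_{\mathcal A}\}$; ${\rm DEC}_{\mathcal A}$ = sets $P\subseteq U_{\mathcal A}^\infty$ with $P$ and $U_{\mathcal A}^\infty\setminus P$ in ${\rm SDEC}_{\mathcal A}$. -}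

module Defs where

open import Data.Nat using (ℕ; zero; suc; _∸_; _<_; _≤?_; s≤s)
open import Data.Fin using (Fin; toℕ; fromℕ; fromℕ<)
open import Data.Fin.Properties using (toℕ<n)
open import Data.Vec using (Vec; []; _∷_; map)
open import Data.List using (List; []; _∷_)
open import Data.List.NonEmpty using (List⁺; _∷_; toList) renaming (length to length⁺)
open import Data.List.Relation.Unary.All using (All)
open import Data.Bool using (Bool; true; false; if_then_else_)
open import Data.Product using (Σ; ∃; _×_; _,_)
open import Data.Sum using (_⊎_)
open import Relation.Nullary using (¬_; yes; no)
open import Relation.Nullary.Decidable using (⌊_⌋)
open import Relation.Binary.PropositionalEquality using (_≡_; subst; sym)
open import Function.Bundles using (_⇔_)

-- Constants are indexed by Fin nConst (N₁), operations by Fin nOp (N₂),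
-- relations by Fin nRel (N₃).  Relations are given by their (Boolean)
-- characteristic functions, since a BSS RAM branches on them.

record Structure : Set₁ where
  field
    U      : Set
    nConst : ℕ
    nOp    : ℕ
    nRel   : ℕ
    const  : Fin nConst → U
    opAr   : Fin nOp → ℕ
    op     : (i : Fin nOp) → Vec U (opAr i) → U
    relAr  : Fin nRel → ℕ
    rel    : (i : Fin nRel) → Vec U (relAr i) → Bool

open Structure public

-- Subsets of U^∞ (non-empty finite tuples).
Subset∞ : Structure → Set₁
Subset∞ A = List⁺ (U A) → Set

-- Encoding convention (0-based): register index j : ℕ stands for Z_{j+1};
-- a stored index-register value v : ℕ stands for the positive integer v+1;
-- index register a : Fin k stands for I_{a+1}.  Labels are Fin (suc L),
-- label ℓ standing for label ℓ+1, and the last label carries stop.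

data Instr (A : Structure) (k : ℕ) (nL : ℕ) : Set where
  opI      : (j : ℕ) (i : Fin (nOp A)) → Vec ℕ (opAr A i) → Instr A k nL
  constI   : (j : ℕ) (i : Fin (nConst A)) → Instr A k nL
  copyI    : (j j' : ℕ) → Instr A k nL
  indCopyI : (a b : Fin k) → Instr A k nL
  indOneI  : (a : Fin k) → Instr A k nL
  indIncI  : (a : Fin k) → Instr A k nL
  relBrI   : (i : Fin (nRel A)) → Vec ℕ (relAr A i) → (l₁ l₂ : Fin nL) → Instr A k nL
  indBrI   : (a b : Fin k) → (l₁ l₂ : Fin nL) → Instr A k nL
  stopI    : Instr A k nL

record Machine (A : Structure) : Set where
  field
    nIdx     : ℕ                          -- k - 1 (there is at least I_1)
    nLab     : ℕ                          -- number of labels minus 1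
    prog     : Fin (suc nLab) → Instr A (suc nIdx) (suc nLab)
    lastStop : prog (fromℕ nLab) ≡ stopI

open Machine public

record Config (A : Structure) (k nL : ℕ) : Set where
  constructor config
  field
    label : Fin nL
    Z     : ℕ → U A
    I     : Fin k → ℕ

open Config public

updZ : {X : Set} → (ℕ → X) → ℕ → X → (ℕ → X)
updZ Z j v i = if ⌊ Data.Nat._≟_ i j ⌋ then v else Z i

updI : {k : ℕ} → (Fin k → ℕ) → Fin k → ℕ → (Fin k → ℕ)
updI I a v b = if ⌊ Data.Fin._≟_ b a ⌋ then v else I b

nextLabel : {L : ℕ} → Fin (suc L) → Fin (suc L)
nextLabel {L} ℓ with suc (toℕ ℓ) ≤? L
... | yes p = fromℕ< (s≤s p)
... | no  _ = ℓ

step : {A : Structure} (M : Machine A) →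
       Config A (suc (nIdx M)) (suc (nLab M)) → Config A (suc (nIdx M)) (suc (nLab M))
step {A} M (config ℓ Z I) with prog M ℓ
... | opI j i js      = config (nextLabel ℓ) (updZ Z j (op A i (map Z js))) I
... | constI j i      = config (nextLabel ℓ) (updZ Z j (const A i)) I
... | copyI j j'      = config (nextLabel ℓ) (updZ Z j (Z j')) I
... | indCopyI a b    = config (nextLabel ℓ) (updZ Z (I a) (Z (I b))) I
... | indOneI a       = config (nextLabel ℓ) Z (updI I a 0)
... | indIncI a       = config (nextLabel ℓ) Z (updI I a (suc (I a)))
... | relBrI i js l₁ l₂ = config (if rel A i (map Z js) then l₁ else l₂) Z I
... | indBrI a b l₁ l₂  = config (if ⌊ Data.Nat._≟_ (I a) (I b) ⌋ then l₁ else l₂) Z I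
... | stopI           = config ℓ Z I

run : {A : Structure} (M : Machine A) → ℕ →
      Config A (suc (nIdx M)) (suc (nLab M)) → Config A (suc (nIdx M)) (suc (nLab M))
run M zero    c = c
run M (suc t) c = run M t (step M c)

initZ : {X : Set} → List⁺ X → ℕ → X
initZ (a ∷ [])       _       = a
initZ (a ∷ (b ∷ bs)) zero    = a
initZ (a ∷ (b ∷ bs)) (suc i) = initZ (b ∷ bs) i

-- I_1 = n (stored as n - 1), all other index registers = 1 (stored as 0).
initI : {k : ℕ} → ℕ → Fin (suc k) → ℕ
initI n Fin.zero    = n ∸ 1
initI n (Fin.suc _) = 0

initConfig : {A : Structure} (M : Machine A) → List⁺ (U A) →
             Config A (suc (nIdx M)) (suc (nLab M))
initConfig M x = config Fin.zero (initZ x) (initI (length⁺ x))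

Halts : {A : Structure} (M : Machine A) → List⁺ (U A) → Set
Halts M x = ∃ λ t → prog M (label (run M t (initConfig M x))) ≡ stopI

SDEC : (A : Structure) → Subset∞ A → Set
SDEC A P = Σ (Machine A) λ M → (x : List⁺ (U A)) → Halts M x ⇔ P x

DEC : (A : Structure) → Subset∞ A → Set
DEC A P = SDEC A P × SDEC A (λ x → ¬ P x)

idSet : (A : Structure) → Subset∞ A
idSet A x = ∃ λ (a : U A) → x ≡ a ∷ (a ∷ [])

singleton : (A : Structure) → U A → Subset∞ A
singleton A c x = x ≡ c ∷ []

pairStar : (A : Structure) → U A → U A → Subset∞ A
pairStar A c₁ c₂ x = All (λ y → y ≡ c₁ ⊎ y ≡ c₂) (toList x)

HasIdRelation : Structure → Set
HasIdRelation A = Σ (Fin (nRel A)) λ i → Σ (relAr A i ≡ 2) λ e →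
  (x y : U A) → rel A i (subst (Vec (U A)) (sym e) (x ∷ y ∷ [])) ≡ true ⇔ x ≡ y

{-# OPTIONS --safe #-}
module Submission where

-- (a) ⇒ (b): with the identity among the relations, one machine checks that the input
-- is a pair of equal elements and another one that it is not; (b) ⇒ (c) is immediate.
-- (c) ⇒ (d): on input (x) every register holds x, so Z₁ := c and n := 2 turn the input
-- into (c, x), on which the semi-decider of the identity halts iff x = c.
-- (d) ⇒ (e): for each input element x the machine runs the semi-deciders of {c₁} and
-- {c₂} on (x) for 0, 1, 2, … steps in turn, until one of them stops. A run of M within
-- a step budget is simulated with register 2r playing Z_r of M and index registers
-- doubled accordingly, below a high-water mark up to which the registers have been
-- reset to x, so that every register M can reach holds x as on input (x). Beforehand
-- the input is copied to odd registers, out of the way of the simulation.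

open import Defs
open import Data.Nat using (ℕ; zero; suc; _+_; _*_; _∸_; _⊔_; _<_; _≤_; _≤?_; _<?_; _≟_; s≤s; z≤n)
open import Data.Nat.Properties
  using (≤-refl; ≤-trans; ≤-antisym; ≤-total; ≤-pred; <⇒≤; <⇒≢; <⇒≱; ≰⇒>; ≮⇒≥; ≤∧≢⇒<; <-≤-trans; ≤-<-trans;
         n≤1+n; m≤n⇒m≤1+n; m≤n⇒m<n∨m≡n; m≤m+n; m≤n+m; m<n+m; m+[n∸m]≡n; m+n∸n≡m; m∸n+n≡m; m∸n≤m;
         m≤n⇒m∸n≡0; ∸-monoˡ-≤; +-suc; +-assoc; +-comm; +-identityʳ; +-cancelʳ-≡; suc-injective;
         m≤m⊔n; m≤n⊔m; m⊔n≤o⇒m≤o; m⊔n≤o⇒n≤o)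
open import Data.Fin as Fin using (Fin; toℕ; fromℕ; fromℕ<; inject₁; _↑ˡ_; _↑ʳ_; #_)
open import Data.Fin.Properties
  using (toℕ-fromℕ; toℕ-fromℕ<; fromℕ<-toℕ; toℕ<n; toℕ≤pred[n]; toℕ-injective; inject₁-injective;
         ↑ˡ-injective; ↑ʳ-injective)
open import Data.Vec using (Vec; []; _∷_; map)
open import Data.Vec.Properties using (map-cong)
open import Data.List using (List; []; _∷_; length)
open import Data.List.NonEmpty using (List⁺; _∷_; head) renaming (length to length⁺)
open import Data.List.Relation.Unary.All using (All; []; _∷_)
open import Data.Bool using (Bool; true; false; if_then_else_)
open import Data.Bool.Properties using (if-eta; if-float)
open import Data.Product using (Σ; ∃; _×_; _,_; proj₁; proj₂)
open import Data.Sum using (_⊎_; inj₁; inj₂)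
open import Data.Empty using (⊥-elim)
open import Relation.Nullary using (¬_; yes; no; Dec)
open import Relation.Nullary.Decidable using (⌊_⌋; isYes≗does; dec-true; dec-false; True; toWitness)
open import Relation.Binary.PropositionalEquality
  using (_≡_; _≢_; _≗_; refl; sym; trans; cong; cong₂; subst; module ≡-Reasoning)
open import Function using (_∘_; flip)
open import Function.Definitions using (Injective)
open import Function.Bundles using (_⇔_; mk⇔; Equivalence)
open import Function.Properties.Equivalence using () renaming (trans to ⇔-trans; sym to ⇔-sym)

-- Programs are written with jump targets in ℕ and are stop from some
-- length on; `compile` turns them into machines by collapsing every
-- out-of-range label onto the final stop label.

data Cmd (A : Structure) (k : ℕ) : Set where
  opC      : (j : ℕ) (i : Fin (nOp A)) → Vec ℕ (opAr A i) → Cmd A k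
  constC   : (j : ℕ) (i : Fin (nConst A)) → Cmd A k
  copyC    : (j j' : ℕ) → Cmd A k
  indCopyC : (a b : Fin k) → Cmd A k
  indOneC  : (a : Fin k) → Cmd A k
  indIncC  : (a : Fin k) → Cmd A k
  relBrC   : (i : Fin (nRel A)) → Vec ℕ (relAr A i) → (l₁ l₂ : ℕ) → Cmd A k
  indBrC   : (a b : Fin k) (l₁ l₂ : ℕ) → Cmd A k
  stopC    : Cmd A k

record Program (A : Structure) : Set where
  constructor program
  field
    nIndex      : ℕ
    size        : ℕ
    cmd         : ℕ → Cmd A (suc nIndex)
    stop-beyond : ∀ p → size ≤ p → cmd p ≡ stopC

open Program public

record State (A : Structure) (k : ℕ) : Set where
  constructor ⟨_,_,_⟩
  field
    pc : ℕ
    Zr : ℕ → U A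
    Ir : Fin k → ℕ

open State public

execCmd : {A : Structure} {k : ℕ} → Cmd A k → ℕ → (ℕ → U A) → (Fin k → ℕ) → State A k
execCmd {A} (opC j i js)        p Z I = ⟨ suc p , updZ Z j (op A i (map Z js)) , I ⟩
execCmd {A} (constC j i)        p Z I = ⟨ suc p , updZ Z j (const A i) , I ⟩
execCmd     (copyC j j')        p Z I = ⟨ suc p , updZ Z j (Z j') , I ⟩
execCmd     (indCopyC a b)      p Z I = ⟨ suc p , updZ Z (I a) (Z (I b)) , I ⟩
execCmd     (indOneC a)         p Z I = ⟨ suc p , Z , updI I a 0 ⟩
execCmd     (indIncC a)         p Z I = ⟨ suc p , Z , updI I a (suc (I a)) ⟩
execCmd {A} (relBrC i js l₁ l₂) p Z I = ⟨ (if rel A i (map Z js) then l₁ else l₂) , Z , I ⟩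
execCmd     (indBrC a b l₁ l₂)  p Z I = ⟨ (if ⌊ I a ≟ I b ⌋ then l₁ else l₂) , Z , I ⟩
execCmd     stopC               p Z I = ⟨ p , Z , I ⟩

module _ {A : Structure} (P : Program A) where

  StateOf : Set
  StateOf = State A (suc (nIndex P))

  exec : StateOf → StateOf
  exec ⟨ p , Z , I ⟩ = execCmd (cmd P p) p Z I

  execute : ℕ → StateOf → StateOf
  execute zero    s = s
  execute (suc t) s = execute t (exec s)

  start : List⁺ (U A) → StateOf
  start x = ⟨ 0 , initZ x , initI (length⁺ x) ⟩

  Stopped : StateOf → Set
  Stopped s = cmd P (pc s) ≡ stopC

  record Reach (s : StateOf) (Q : StateOf → Set) : Set where
    constructor reach
    field
      steps   : ℕ
      reached : Q (execute steps s)

  HaltsFrom : StateOf → Set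
  HaltsFrom s = Reach s Stopped

  Accepts : List⁺ (U A) → Set
  Accepts x = HaltsFrom (start x)

stepInstr : {A : Structure} (M : Machine A) → Instr A (suc (nIdx M)) (suc (nLab M)) →
            Fin (suc (nLab M)) → (ℕ → U A) → (Fin (suc (nIdx M)) → ℕ) →
            Config A (suc (nIdx M)) (suc (nLab M))
stepInstr {A} M (opI j i js)        ℓ Z I = config (nextLabel ℓ) (updZ Z j (op A i (map Z js))) I
stepInstr {A} M (constI j i)        ℓ Z I = config (nextLabel ℓ) (updZ Z j (const A i)) I
stepInstr     M (copyI j j')        ℓ Z I = config (nextLabel ℓ) (updZ Z j (Z j')) I
stepInstr     M (indCopyI a b)      ℓ Z I = config (nextLabel ℓ) (updZ Z (I a) (Z (I b))) I
stepInstr     M (indOneI a)         ℓ Z I = config (nextLabel ℓ) Z (updI I a 0)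
stepInstr     M (indIncI a)         ℓ Z I = config (nextLabel ℓ) Z (updI I a (suc (I a)))
stepInstr {A} M (relBrI i js l₁ l₂) ℓ Z I = config (if rel A i (map Z js) then l₁ else l₂) Z I
stepInstr     M (indBrI a b l₁ l₂)  ℓ Z I = config (if ⌊ I a ≟ I b ⌋ then l₁ else l₂) Z I
stepInstr     M stopI               ℓ Z I = config ℓ Z I

step≡stepInstr : {A : Structure} (M : Machine A) (ℓ : Fin (suc (nLab M))) → ∀ Z I →
                 step M (config ℓ Z I) ≡ stepInstr M (prog M ℓ) ℓ Z I
step≡stepInstr M ℓ Z I with prog M ℓ
... | opI _ _ _      = refl
... | constI _ _     = refl
... | copyI _ _      = refl
... | indCopyI _ _   = refl
... | indOneI _      = refl
... | indIncI _      = refl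
... | relBrI _ _ _ _ = refl
... | indBrI _ _ _ _ = refl
... | stopI          = refl

StopsAfter : {A : Structure} (M : Machine A) → Config A (suc (nIdx M)) (suc (nLab M)) → ℕ → Set
StopsAfter M c t = prog M (label (run M t c)) ≡ stopI

HaltsFromConfig : {A : Structure} (M : Machine A) → Config A (suc (nIdx M)) (suc (nLab M)) → Set
HaltsFromConfig M c = ∃ (StopsAfter M c)

module _ {A : Structure} (M : Machine A) where

  run-+ : ∀ a b c → run M (a + b) c ≡ run M b (run M a c)
  run-+ zero    b c = refl
  run-+ (suc a) b c = run-+ a b (step M c)

  run-suc : ∀ t c → run M (suc t) c ≡ step M (run M t c)
  run-suc zero    c = refl
  run-suc (suc t) c = run-suc t (step M c)

  run-stopped : ∀ t c → prog M (label c) ≡ stopI → run M t c ≡ c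
  run-stopped zero    c stop = refl
  run-stopped (suc t) (config ℓ Zs Is) stop rewrite step≡stepInstr M ℓ Zs Is | stop =
    run-stopped t (config ℓ Zs Is) stop

  stopsAfter-mono : ∀ c {s t} → s ≤ t → StopsAfter M c s → StopsAfter M c t
  stopsAfter-mono c {s} {t} s≤t stop = subst (StopsAfter M c) (m+[n∸m]≡n s≤t) (trans (cong (prog M ∘ label) stays) stop)
    where
    stays : run M (s + (t ∸ s)) c ≡ run M s c
    stays = trans (run-+ s (t ∸ s) c) (run-stopped (t ∸ s) (run M s c) stop)

progℕ : {A : Structure} (M : Machine A) → ℕ → Instr A (suc (nIdx M)) (suc (nLab M))
progℕ M q with q <? suc (nLab M)
... | yes q<L = prog M (fromℕ< q<L)
... | no  _   = stopI

progℕ-toℕ : {A : Structure} (M : Machine A) (ℓ : Fin (suc (nLab M))) → progℕ M (toℕ ℓ) ≡ prog M ℓ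
progℕ-toℕ M ℓ with toℕ ℓ <? suc (nLab M)
... | yes ℓ<L = cong (prog M) (fromℕ<-toℕ ℓ ℓ<L)
... | no  ℓ≮L = ⊥-elim (ℓ≮L (toℕ<n ℓ))

progℕ-beyond : {A : Structure} (M : Machine A) → ∀ q → nLab M ≤ q → progℕ M q ≡ stopI
progℕ-beyond M q L≤q with q <? suc (nLab M)
... | no  _   = refl
... | yes q<L = trans (cong (prog M) (toℕ-injective q≡L)) (lastStop M)
  where
  q≡L : toℕ (fromℕ< q<L) ≡ toℕ (fromℕ (nLab M))
  q≡L = trans (toℕ-fromℕ< q<L) (trans (≤-antisym (≤-pred q<L) L≤q) (sym (toℕ-fromℕ (nLab M))))

label<nLab : {A : Structure} (M : Machine A) (ℓ : Fin (suc (nLab M))) → prog M ℓ ≢ stopI → toℕ ℓ < nLab M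
label<nLab M ℓ ¬stop with m≤n⇒m<n∨m≡n (toℕ≤pred[n] ℓ)
... | inj₁ ℓ<L = ℓ<L
... | inj₂ ℓ≡L = ⊥-elim (¬stop (trans (cong (prog M) ℓ≡last) (lastStop M)))
  where
  ℓ≡last : ℓ ≡ fromℕ (nLab M)
  ℓ≡last = toℕ-injective (trans ℓ≡L (sym (toℕ-fromℕ (nLab M))))

toℕ-nextLabel : {L : ℕ} (ℓ : Fin (suc L)) → toℕ ℓ < L → toℕ (nextLabel ℓ) ≡ suc (toℕ ℓ)
toℕ-nextLabel {L} ℓ ℓ<L with suc (toℕ ℓ) ≤? L
... | yes p = toℕ-fromℕ< (s≤s p)
... | no ¬p = ⊥-elim (¬p ℓ<L)

clampLabel : (L : ℕ) → ℕ → Fin (suc L)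
clampLabel L p with p ≤? L
... | yes p≤L = fromℕ< (s≤s p≤L)
... | no  _   = fromℕ L

compileCmd : {A : Structure} {k L : ℕ} → Cmd A k → Instr A k (suc L)
compileCmd         (opC j i js)        = opI j i js
compileCmd         (constC j i)        = constI j i
compileCmd         (copyC j j')        = copyI j j'
compileCmd         (indCopyC a b)      = indCopyI a b
compileCmd         (indOneC a)         = indOneI a
compileCmd         (indIncC a)         = indIncI a
compileCmd {L = L} (relBrC i js l₁ l₂) = relBrI i js (clampLabel L l₁) (clampLabel L l₂)
compileCmd {L = L} (indBrC a b l₁ l₂)  = indBrI a b (clampLabel L l₁) (clampLabel L l₂)
compileCmd         stopC               = stopI

compile : {A : Structure} → Program A → Machine A
compile P = record
  { nIdx     = nIndex P
  ; nLab     = size P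
  ; prog     = λ ℓ → compileCmd (cmd P (toℕ ℓ))
  ; lastStop = last-stop
  }
  where
  last-stop : compileCmd (cmd P (toℕ (fromℕ (size P)))) ≡ stopI
  last-stop rewrite toℕ-fromℕ (size P) | stop-beyond P (size P) ≤-refl = refl

module _ {A : Structure} (P : Program A) where

  private
    L = size P

  LabelTracks : Fin (suc L) → ℕ → Set
  LabelTracks ℓ p = toℕ ℓ ≡ p ⊎ (toℕ ℓ ≡ L × L ≤ p)

  record Tracks (c : Config A (suc (nIndex P)) (suc L)) (s : StateOf P) : Set where
    constructor tracks
    field
      label-tracks : LabelTracks (label c) (pc s)
      Z≡           : Z c ≡ Zr s
      I≡           : I c ≡ Ir s

  clampLabel-tracks : ∀ p → LabelTracks (clampLabel L p) p
  clampLabel-tracks p with p ≤? L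
  ... | yes p≤L = inj₁ (toℕ-fromℕ< (s≤s p≤L))
  ... | no  p≰L = inj₂ (toℕ-fromℕ L , <⇒≤ (≰⇒> p≰L))

  branch-tracks : (b : Bool) (l₁ l₂ : ℕ) →
    LabelTracks (if b then clampLabel L l₁ else clampLabel L l₂) (if b then l₁ else l₂)
  branch-tracks true  l₁ l₂ = clampLabel-tracks l₁
  branch-tracks false l₁ l₂ = clampLabel-tracks l₂

  <size-of-non-stop : ∀ p → cmd P p ≢ stopC → p < L
  <size-of-non-stop p ¬stop with p <? L
  ... | yes p<L = p<L
  ... | no  p≮L = ⊥-elim (¬stop (stop-beyond P p (≮⇒≥ p≮L)))

  advance-tracks : ∀ {ℓ p κ} → toℕ ℓ ≡ p → cmd P p ≡ κ → κ ≢ stopC →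
                   LabelTracks (nextLabel ℓ) (suc p)
  advance-tracks {ℓ} {p} ℓ≡p κ≡ κ≢stop =
    inj₁ (trans (toℕ-nextLabel ℓ (subst (_< L) (sym ℓ≡p) p<L)) (cong suc ℓ≡p))
    where
    p<L : p < L
    p<L = <size-of-non-stop p (λ stop → κ≢stop (trans (sym κ≡) stop))

  cmd-tracks : ∀ {ℓ p} Z I → toℕ ℓ ≡ p →
    Tracks (stepInstr (compile P) (compileCmd (cmd P p)) ℓ Z I) (execCmd (cmd P p) p Z I)
  cmd-tracks {ℓ} {p} Z I ℓ≡p with cmd P p in κ≡
  ... | opC _ _ _         = tracks (advance-tracks ℓ≡p κ≡ λ ()) refl refl
  ... | constC _ _        = tracks (advance-tracks ℓ≡p κ≡ λ ()) refl refl
  ... | copyC _ _         = tracks (advance-tracks ℓ≡p κ≡ λ ()) refl refl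
  ... | indCopyC _ _      = tracks (advance-tracks ℓ≡p κ≡ λ ()) refl refl
  ... | indOneC _         = tracks (advance-tracks ℓ≡p κ≡ λ ()) refl refl
  ... | indIncC _         = tracks (advance-tracks ℓ≡p κ≡ λ ()) refl refl
  ... | relBrC i js l₁ l₂ = tracks (branch-tracks (rel A i (map Z js)) l₁ l₂) refl refl
  ... | indBrC a b l₁ l₂  = tracks (branch-tracks ⌊ I a ≟ I b ⌋ l₁ l₂) refl refl
  ... | stopC             = tracks (inj₁ ℓ≡p) refl refl

  step-tracks : ∀ c s → Tracks c s → Tracks (step (compile P) c) (exec P s)
  step-tracks (config ℓ Zs Is) ⟨ p , .Zs , .Is ⟩ (tracks (inj₁ ℓ≡p) refl refl)
    rewrite step≡stepInstr (compile P) ℓ Zs Is | ℓ≡p = cmd-tracks Zs Is ℓ≡p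
  step-tracks (config ℓ Zs Is) ⟨ p , .Zs , .Is ⟩ (tracks (inj₂ (ℓ≡L , L≤p)) refl refl)
    rewrite step≡stepInstr (compile P) ℓ Zs Is | ℓ≡L | stop-beyond P p L≤p | stop-beyond P L ≤-refl =
    tracks (inj₂ (ℓ≡L , L≤p)) refl refl

  run-tracks : ∀ t c s → Tracks c s → Tracks (run (compile P) t c) (execute P t s)
  run-tracks zero    c s c~s = c~s
  run-tracks (suc t) c s c~s = run-tracks t (step (compile P) c) (exec P s) (step-tracks c s c~s)

  compileCmd-stop : ∀ (κ : Cmd A (suc (nIndex P))) → compileCmd {L = L} κ ≡ stopI ⇔ κ ≡ stopC
  compileCmd-stop κ = mk⇔ (to κ) λ { refl → refl }
    where
    to : ∀ κ → compileCmd {L = L} κ ≡ stopI → κ ≡ stopC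
    to stopC _ = refl

  stopped-tracks : ∀ c s → Tracks c s → prog (compile P) (label c) ≡ stopI ⇔ Stopped P s
  stopped-tracks (config ℓ _ _) ⟨ p , _ , _ ⟩ (tracks (inj₁ ℓ≡p) _ _) rewrite ℓ≡p =
    compileCmd-stop (cmd P p)
  stopped-tracks (config ℓ _ _) ⟨ p , _ , _ ⟩ (tracks (inj₂ (ℓ≡L , L≤p)) _ _)
    rewrite ℓ≡L | stop-beyond P p L≤p | stop-beyond P L ≤-refl = mk⇔ (λ _ → refl) (λ _ → refl)

  compile-halts : ∀ x → Halts (compile P) x ⇔ Accepts P x
  compile-halts x = mk⇔ (λ (t , h) → reach t (to (stopped-tracks _ _ (tracks-at t)) h))
                        (λ (reach t h) → t , from (stopped-tracks _ _ (tracks-at t)) h)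
    where
    open Equivalence
    tracks-at : ∀ t → Tracks (run (compile P) t (initConfig (compile P) x)) (execute P t (start P x))
    tracks-at t = run-tracks t _ _ (tracks (inj₁ refl) refl refl)

updZ-same : {X : Set} (Zs : ℕ → X) (j : ℕ) (v : X) → updZ Zs j v j ≡ v
updZ-same Zs j v with j ≟ j
... | yes _ = refl
... | no j≢j = ⊥-elim (j≢j refl)

updZ-other : {X : Set} (Zs : ℕ → X) (j : ℕ) (v : X) (i : ℕ) → i ≢ j → updZ Zs j v i ≡ Zs i
updZ-other Zs j v i i≢j with i ≟ j
... | yes i≡j = ⊥-elim (i≢j i≡j)
... | no _    = refl

updZ-cong : {X : Set} {Z₁ Z₂ : ℕ → X} → Z₁ ≗ Z₂ → ∀ j {v₁ v₂ : X} → v₁ ≡ v₂ →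
            updZ Z₁ j v₁ ≗ updZ Z₂ j v₂
updZ-cong Z₁≗Z₂ j refl i with i ≟ j
... | yes _ = refl
... | no _  = Z₁≗Z₂ i

updI-same : {k : ℕ} (Is : Fin k → ℕ) (a : Fin k) (v : ℕ) → updI Is a v a ≡ v
updI-same Is a v with a Fin.≟ a
... | yes _ = refl
... | no a≢a = ⊥-elim (a≢a refl)

updI-other : {k : ℕ} (Is : Fin k → ℕ) (a : Fin k) (v : ℕ) (b : Fin k) → b ≢ a → updI Is a v b ≡ Is b
updI-other Is a v b b≢a with b Fin.≟ a
... | yes b≡a = ⊥-elim (b≢a b≡a)
... | no _    = refl

updI-cong : {k : ℕ} {I₁ I₂ : Fin k → ℕ} → I₁ ≗ I₂ → ∀ a {v₁ v₂} → v₁ ≡ v₂ →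
            updI I₁ a v₁ ≗ updI I₂ a v₂
updI-cong I₁≗I₂ a refl b with b Fin.≟ a
... | yes _ = refl
... | no _  = I₁≗I₂ b

updI-twice : {k : ℕ} (Is : Fin k → ℕ) (a : Fin k) (v w : ℕ) → updI (updI Is a v) a w ≗ updI Is a w
updI-twice Is a v w b with b Fin.≟ a
... | yes _ = refl
... | no _  = refl

updI-∘ : {k k' : ℕ} (f : Fin k → Fin k') → Injective _≡_ _≡_ f →
         (Is : Fin k' → ℕ) (a : Fin k) (v : ℕ) (b : Fin k) → updI Is (f a) v (f b) ≡ updI (Is ∘ f) a v b
updI-∘ f f-inj Is a v b with b Fin.≟ a | f b Fin.≟ f a
... | yes _    | yes _     = refl
... | yes refl | no fb≢fa  = ⊥-elim (fb≢fa refl)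
... | no b≢a   | yes fb≡fa = ⊥-elim (b≢a (f-inj fb≡fa))
... | no _     | no _      = refl

goto : {A : Structure} {k : ℕ} → ℕ → Cmd A (suc k)
goto l = indBrC Fin.zero Fin.zero l l

module RunReasoning {A : Structure} (P : Program A) where

  execute-+ : ∀ a b s → execute P (a + b) s ≡ execute P b (execute P a s)
  execute-+ zero    b s = refl
  execute-+ (suc a) b s = execute-+ a b (exec P s)

  exec-at : ∀ {p κ} Zs Is → cmd P p ≡ κ → exec P ⟨ p , Zs , Is ⟩ ≡ execCmd κ p Zs Is
  exec-at Zs Is κ≡ rewrite κ≡ = refl

  exec-stopped : ∀ s → Stopped P s → exec P s ≡ s
  exec-stopped ⟨ p , Zs , Is ⟩ stop = exec-at Zs Is stop

  execute-stopped : ∀ t s → Stopped P s → execute P t s ≡ s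
  execute-stopped zero    s stop = refl
  execute-stopped (suc t) s stop rewrite exec-stopped s stop = execute-stopped t s stop

  stopped-later : ∀ t k s → Stopped P (execute P t s) → Stopped P (execute P (t ∸ k) (execute P k s))
  stopped-later t k s stop with ≤-total k t
  ... | inj₁ k≤t rewrite sym (execute-+ k (t ∸ k) s) | m+[n∸m]≡n k≤t = stop
  ... | inj₂ t≤k rewrite m≤n⇒m∸n≡0 t≤k | sym (m+[n∸m]≡n t≤k) | execute-+ t (k ∸ t) s
                       | execute-stopped (k ∸ t) (execute P t s) stop = stop

  reach-here : ∀ {s Q} → Q s → Reach P s Q
  reach-here q = reach 0 q

  reach-step : ∀ {s Q} → Reach P (exec P s) Q → Reach P s Q
  reach-step (reach t q) = reach (suc t) q

  reach-bind : ∀ {s Q R} → Reach P s Q → (∀ s' → Q s' → Reach P s' R) → Reach P s R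
  reach-bind {s} {R = R} (reach t q) k with k _ q
  ... | reach t' r = reach (t + t') (subst R (sym (execute-+ t t' s)) r)

  reach-bind⁺ : ∀ {s Q R} → Reach P s Q → (∀ s' → Q s' → Reach P (exec P s') R) → Reach P (exec P s) R
  reach-bind⁺ {s} {R = R} (reach t q) k with k _ q
  ... | reach t' r = reach (t + t') (subst R (trans (sym (execute-+ t (suc t') s)) (cong (flip (execute P) s) (+-suc t t'))) r)

  after-cmd : ∀ {p κ Zs Is Q} → cmd P p ≡ κ →
              Reach P (execCmd κ p Zs Is) Q → Reach P (exec P ⟨ p , Zs , Is ⟩) Q
  after-cmd {Zs = Zs} {Is} {Q} κ≡ = subst (λ s → Reach P s Q) (sym (exec-at Zs Is κ≡))

  after-if-≡ : ∀ {p a b l₁ l₂ Zs Is Q} → cmd P p ≡ indBrC a b l₁ l₂ → Is a ≡ Is b →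
    Reach P ⟨ l₁ , Zs , Is ⟩ Q → Reach P (exec P ⟨ p , Zs , Is ⟩) Q
  after-if-≡ {a = a} {b} {l₁} {l₂} {Zs} {Is} {Q} κ≡ eq r =
    after-cmd κ≡ (subst (λ l → Reach P ⟨ l , Zs , Is ⟩ Q) (sym taken) r)
    where
    taken : (if ⌊ Is a ≟ Is b ⌋ then l₁ else l₂) ≡ l₁
    taken = cong (if_then l₁ else l₂) (trans (isYes≗does _) (dec-true (Is a ≟ Is b) eq))

  after-if-≢ : ∀ {p a b l₁ l₂ Zs Is Q} → cmd P p ≡ indBrC a b l₁ l₂ → Is a ≢ Is b →
    Reach P ⟨ l₂ , Zs , Is ⟩ Q → Reach P (exec P ⟨ p , Zs , Is ⟩) Q
  after-if-≢ {a = a} {b} {l₁} {l₂} {Zs} {Is} {Q} κ≡ ne r =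
    after-cmd κ≡ (subst (λ l → Reach P ⟨ l , Zs , Is ⟩ Q) (sym taken) r)
    where
    taken : (if ⌊ Is a ≟ Is b ⌋ then l₁ else l₂) ≡ l₂
    taken = cong (if_then l₁ else l₂) (trans (isYes≗does _) (dec-false (Is a ≟ Is b) ne))

  after-goto : ∀ {p l Zs Is Q} → cmd P p ≡ goto l →
               Reach P ⟨ l , Zs , Is ⟩ Q → Reach P (exec P ⟨ p , Zs , Is ⟩) Q
  after-goto κ≡ = after-if-≡ κ≡ refl

  reach-cmd : ∀ {p κ Zs Is Q} → cmd P p ≡ κ →
              Reach P (execCmd κ p Zs Is) Q → Reach P ⟨ p , Zs , Is ⟩ Q
  reach-cmd κ≡ r = reach-step (after-cmd κ≡ r)

  reach-if-≡ : ∀ {p a b l₁ l₂ Zs Is Q} → cmd P p ≡ indBrC a b l₁ l₂ → Is a ≡ Is b →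
    Reach P ⟨ l₁ , Zs , Is ⟩ Q → Reach P ⟨ p , Zs , Is ⟩ Q
  reach-if-≡ κ≡ eq r = reach-step (after-if-≡ κ≡ eq r)

  reach-if-≢ : ∀ {p a b l₁ l₂ Zs Is Q} → cmd P p ≡ indBrC a b l₁ l₂ → Is a ≢ Is b →
    Reach P ⟨ l₂ , Zs , Is ⟩ Q → Reach P ⟨ p , Zs , Is ⟩ Q
  reach-if-≢ κ≡ ne r = reach-step (after-if-≢ κ≡ ne r)

  reach-goto : ∀ {p l Zs Is Q} → cmd P p ≡ goto l →
               Reach P ⟨ l , Zs , Is ⟩ Q → Reach P ⟨ p , Zs , Is ⟩ Q
  reach-goto κ≡ r = reach-step (after-goto κ≡ r)

  reach-rel : ∀ {p i js l₁ l₂ b Zs Is Q} → cmd P p ≡ relBrC i js l₁ l₂ → rel A i (map Zs js) ≡ b →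
    Reach P ⟨ (if b then l₁ else l₂) , Zs , Is ⟩ Q → Reach P ⟨ p , Zs , Is ⟩ Q
  reach-rel κ≡ refl r = reach-cmd κ≡ r

  goto-self-diverges : ∀ {p Zs Is} → cmd P p ≡ goto p → ¬ HaltsFrom P ⟨ p , Zs , Is ⟩
  goto-self-diverges {p} {Zs} {Is} κ≡ (reach t stop) = never t stop
    where
    fixed : exec P ⟨ p , Zs , Is ⟩ ≡ ⟨ p , Zs , Is ⟩
    fixed = trans (exec-at Zs Is κ≡) (cong (λ l → ⟨ l , Zs , Is ⟩) (if-eta _))
    never : ∀ t → ¬ Stopped P (execute P t ⟨ p , Zs , Is ⟩)
    never zero    stop with trans (sym κ≡) stop
    ... | ()
    never (suc t) stop = never t (subst (λ s → Stopped P (execute P t s)) fixed stop)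

  halts-later : ∀ {s} k → HaltsFrom P (execute P k s) → HaltsFrom P s
  halts-later {s} k (reach t stop) = reach (k + t) (subst (Stopped P) (sym (execute-+ k t s)) stop)

  halts-earlier : ∀ {s} k → HaltsFrom P s → HaltsFrom P (execute P k s)
  halts-earlier {s} k (reach t stop) = reach (t ∸ k) (stopped-later t k s stop)

  halts-after : ∀ {s} k → HaltsFrom P s ⇔ HaltsFrom P (execute P k s)
  halts-after k = mk⇔ (halts-earlier k) (halts-later k)

  diverges-via : ∀ {s} → Reach P s (λ s' → ¬ HaltsFrom P s') → ¬ HaltsFrom P s
  diverges-via (reach k diverges) halts = diverges (halts-earlier k halts)

-- Deciding the identity

map-subst : {X Y : Set} (f : X → Y) {n : ℕ} (e : n ≡ 2) (v : Vec X 2) →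
            map f (subst (Vec X) (sym e) v) ≡ subst (Vec Y) (sym e) (map f v)
map-subst f refl v = refl

module _ {A : Structure} (hasId : HasIdRelation A) where

  private
    eqRel = proj₁ hasId
    arity = proj₁ (proj₂ hasId)

    args01 : Vec ℕ (relAr A eqRel)
    args01 = subst (Vec ℕ) (sym arity) (0 ∷ 1 ∷ [])

    I₁ I₂ : Fin 2
    I₁ = Fin.zero
    I₂ = Fin.suc Fin.zero

  rel-args01 : ∀ Zs → rel A eqRel (map Zs args01) ≡ true ⇔ Zs 0 ≡ Zs 1
  rel-args01 Zs rewrite map-subst Zs arity (0 ∷ 1 ∷ []) = proj₂ (proj₂ hasId) (Zs 0) (Zs 1)

  -- Both programs first test n = 2 by comparing I₁ with I₂ raised to 2.
  equalPairCode : ℕ → Cmd A 2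
  equalPairCode 0 = indIncC I₂
  equalPairCode 1 = indBrC I₁ I₂ 3 2
  equalPairCode 2 = goto 2
  equalPairCode 3 = relBrC eqRel args01 4 2
  equalPairCode _ = stopC

  unequalPairCode : ℕ → Cmd A 2
  unequalPairCode 0 = indIncC I₂
  unequalPairCode 1 = indBrC I₁ I₂ 3 2
  unequalPairCode 2 = goto 5
  unequalPairCode 3 = relBrC eqRel args01 4 5
  unequalPairCode 4 = goto 4
  unequalPairCode _ = stopC

  equalPair : Program A
  equalPair = program 1 4 equalPairCode λ { _ (s≤s (s≤s (s≤s (s≤s _)))) → refl }

  unequalPair : Program A
  unequalPair = program 1 5 unequalPairCode λ { _ (s≤s (s≤s (s≤s (s≤s (s≤s _))))) → refl }

  equalPair-accepts : ∀ x → Accepts equalPair x ⇔ idSet A x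
  equalPair-accepts (a ∷ []) =
    mk⇔ (⊥-elim ∘ diverges-via (reach-cmd refl (reach-if-≢ refl (λ ()) (reach-here (goto-self-diverges refl)))))
        λ { (_ , ()) }
    where open RunReasoning equalPair
  equalPair-accepts (a ∷ _ ∷ _ ∷ _) =
    mk⇔ (⊥-elim ∘ diverges-via (reach-cmd refl (reach-if-≢ refl (λ ()) (reach-here (goto-self-diverges refl)))))
        λ { (_ , ()) }
    where open RunReasoning equalPair
  equalPair-accepts (a ∷ b ∷ []) = mk⇔ to from
    where
    open RunReasoning equalPair
    Zs = initZ (a ∷ b ∷ [])
    to : Accepts equalPair (a ∷ b ∷ []) → idSet A (a ∷ b ∷ [])
    to halts with rel A eqRel (map Zs args01) in holds
    ... | true  = a , cong (λ y → a ∷ y ∷ []) (sym (Equivalence.to (rel-args01 Zs) holds))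
    ... | false = ⊥-elim (diverges-via (reach-cmd refl (reach-if-≡ refl refl
                    (reach-rel refl holds (reach-here (goto-self-diverges refl))))) halts)
    from : idSet A (a ∷ b ∷ []) → Accepts equalPair (a ∷ b ∷ [])
    from (_ , refl) = reach-cmd refl (reach-if-≡ refl refl
                        (reach-rel refl (Equivalence.from (rel-args01 Zs) refl) (reach-here refl)))

  unequalPair-accepts : ∀ x → Accepts unequalPair x ⇔ (¬ idSet A x)
  unequalPair-accepts (a ∷ []) =
    mk⇔ (λ _ → λ { (_ , ()) }) λ _ → reach-cmd refl (reach-if-≢ refl (λ ()) (reach-goto refl (reach-here refl)))
    where open RunReasoning unequalPair
  unequalPair-accepts (a ∷ _ ∷ _ ∷ _) =
    mk⇔ (λ _ → λ { (_ , ()) }) λ _ → reach-cmd refl (reach-if-≢ refl (λ ()) (reach-goto refl (reach-here refl)))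
    where open RunReasoning unequalPair
  unequalPair-accepts (a ∷ b ∷ []) = mk⇔ to from
    where
    open RunReasoning unequalPair
    Zs = initZ (a ∷ b ∷ [])
    to : Accepts unequalPair (a ∷ b ∷ []) → ¬ idSet A (a ∷ b ∷ [])
    to halts (_ , refl) = diverges-via (reach-cmd refl (reach-if-≡ refl refl
      (reach-rel refl (Equivalence.from (rel-args01 Zs) refl) (reach-here (goto-self-diverges refl))))) halts
    from : ¬ idSet A (a ∷ b ∷ []) → Accepts unequalPair (a ∷ b ∷ [])
    from unequal with rel A eqRel (map Zs args01) in holds
    ... | true  = ⊥-elim (unequal (a , cong (λ y → a ∷ y ∷ []) (sym (Equivalence.to (rel-args01 Zs) holds))))
    ... | false = reach-cmd refl (reach-if-≡ refl refl (reach-rel refl holds (reach-here refl)))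

  idSet-dec : DEC A (idSet A)
  idSet-dec = (compile equalPair   , λ x → ⇔-trans (compile-halts equalPair x) (equalPair-accepts x))
            , (compile unequalPair , λ x → ⇔-trans (compile-halts unequalPair x) (unequalPair-accepts x))

-- Singletons from the identity

module SingletonByPairing {A : Structure} (M : Machine A) (ci : Fin (nConst A)) where

  private
    K = nIdx M
    L = nLab M
    c = const A ci

  embed : Fin (suc K) → Fin (suc (suc K))
  embed = inject₁

  extra : Fin (suc (suc K))
  extra = fromℕ (suc K)

  shift : Fin (suc L) → ℕ
  shift ℓ = 4 + toℕ ℓ

  relabel : Instr A (suc K) (suc L) → Cmd A (suc (suc K))
  relabel (opI j i js)        = opC j i js
  relabel (constI j i)        = constC j i
  relabel (copyI j j')        = copyC j j'
  relabel (indCopyI a b)      = indCopyC (embed a) (embed b)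
  relabel (indOneI a)         = indOneC (embed a)
  relabel (indIncI a)         = indIncC (embed a)
  relabel (relBrI i js l₁ l₂) = relBrC i js (shift l₁) (shift l₂)
  relabel (indBrI a b l₁ l₂)  = indBrC (embed a) (embed b) (shift l₁) (shift l₂)
  relabel stopI               = stopC

  code : ℕ → Cmd A (suc (suc K))
  code 0 = indBrC Fin.zero extra 2 1
  code 1 = goto 1
  code 2 = constC 0 ci
  code 3 = indIncC Fin.zero
  code (suc (suc (suc (suc q)))) = relabel (progℕ M q)

  P : Program A
  P = program (suc K) (4 + L) code beyond
    where
    beyond : ∀ p → 4 + L ≤ p → code p ≡ stopC
    beyond (suc (suc (suc (suc q)))) (s≤s (s≤s (s≤s (s≤s L≤q)))) = cong relabel (progℕ-beyond M q L≤q)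

  record Embeds (cf : Config A (suc K) (suc L)) (s : StateOf P) : Set where
    constructor embeds
    field
      pc≡ : pc s ≡ shift (label cf)
      Z≗  : Zr s ≗ Z cf
      I≗  : Ir s ∘ embed ≗ I cf

  shift-next : (ℓ : Fin (suc L)) → toℕ ℓ < L → suc (shift ℓ) ≡ shift (nextLabel ℓ)
  shift-next ℓ ℓ<L = cong (4 +_) (sym (toℕ-nextLabel ℓ ℓ<L))


  embed-upd : ∀ {Is Im} → Is ∘ embed ≗ Im → ∀ a {v v'} → v ≡ v' → updI Is (embed a) v ∘ embed ≗ updI Im a v'
  embed-upd {Is} Is≗Im a v≡v' b = trans (updI-∘ embed inject₁-injective Is a _ b) (updI-cong Is≗Im a v≡v' b)

  instr-embeds : ∀ ℓ Zm Im Zs Is → Zs ≗ Zm → Is ∘ embed ≗ Im →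
    (ins : Instr A (suc K) (suc L)) → (ins ≢ stopI → toℕ ℓ < L) →
    Embeds (stepInstr M ins ℓ Zm Im) (execCmd (relabel ins) (shift ℓ) Zs Is)
  instr-embeds ℓ Zm Im Zs Is Z≗ I≗ (opI j i js) ℓ<L =
    embeds (shift-next ℓ (ℓ<L λ ())) (updZ-cong Z≗ j (cong (op A i) (map-cong Z≗ js))) I≗
  instr-embeds ℓ Zm Im Zs Is Z≗ I≗ (constI j i) ℓ<L =
    embeds (shift-next ℓ (ℓ<L λ ())) (updZ-cong Z≗ j refl) I≗
  instr-embeds ℓ Zm Im Zs Is Z≗ I≗ (copyI j j') ℓ<L =
    embeds (shift-next ℓ (ℓ<L λ ())) (updZ-cong Z≗ j (Z≗ j')) I≗
  instr-embeds ℓ Zm Im Zs Is Z≗ I≗ (indCopyI a b) ℓ<L rewrite I≗ a | I≗ b =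
    embeds (shift-next ℓ (ℓ<L λ ())) (updZ-cong Z≗ (Im a) (Z≗ (Im b))) I≗
  instr-embeds ℓ Zm Im Zs Is Z≗ I≗ (indOneI a) ℓ<L =
    embeds (shift-next ℓ (ℓ<L λ ())) Z≗ (embed-upd {Is} I≗ a refl)
  instr-embeds ℓ Zm Im Zs Is Z≗ I≗ (indIncI a) ℓ<L =
    embeds (shift-next ℓ (ℓ<L λ ())) Z≗ (embed-upd {Is} I≗ a (cong suc (I≗ a)))
  instr-embeds ℓ Zm Im Zs Is Z≗ I≗ (relBrI i js l₁ l₂) ℓ<L rewrite map-cong Z≗ js =
    embeds (sym (if-float shift (rel A i (map Zm js)))) Z≗ I≗
  instr-embeds ℓ Zm Im Zs Is Z≗ I≗ (indBrI a b l₁ l₂) ℓ<L rewrite I≗ a | I≗ b =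
    embeds (sym (if-float shift ⌊ Im a ≟ Im b ⌋)) Z≗ I≗
  instr-embeds ℓ Zm Im Zs Is Z≗ I≗ stopI ℓ<L = embeds refl Z≗ I≗

  step-embeds : ∀ cf s → Embeds cf s → Embeds (step M cf) (exec P s)
  step-embeds (config ℓ Zm Im) ⟨ p , Zs , Is ⟩ (embeds refl Z≗ I≗)
    rewrite step≡stepInstr M ℓ Zm Im | progℕ-toℕ M ℓ =
    instr-embeds ℓ Zm Im Zs Is Z≗ I≗ (prog M ℓ) (label<nLab M ℓ)

  run-embeds : ∀ t cf s → Embeds cf s → Embeds (run M t cf) (execute P t s)
  run-embeds zero    cf s cf~s = cf~s
  run-embeds (suc t) cf s cf~s = run-embeds t (step M cf) (exec P s) (step-embeds cf s cf~s)

  relabel-stop : ∀ ins → ins ≡ stopI ⇔ relabel ins ≡ stopC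
  relabel-stop ins = mk⇔ (λ { refl → refl }) (from ins)
    where
    from : ∀ ins → relabel ins ≡ stopC → ins ≡ stopI
    from stopI _ = refl

  stopped-embeds : ∀ cf s → Embeds cf s → prog M (label cf) ≡ stopI ⇔ Stopped P s
  stopped-embeds (config ℓ _ _) ⟨ p , _ , _ ⟩ (embeds refl _ _) rewrite progℕ-toℕ M ℓ =
    relabel-stop (prog M ℓ)

  halts-embeds : ∀ cf s → Embeds cf s → HaltsFromConfig M cf ⇔ HaltsFrom P s
  halts-embeds cf s cf~s = mk⇔
    (λ (t , stop) → reach t (Equivalence.to (stopped-embeds _ _ (run-embeds t cf s cf~s)) stop))
    (λ (reach t stop) → t , Equivalence.from (stopped-embeds _ _ (run-embeds t cf s cf~s)) stop)

  paired-input : ∀ x → Embeds (initConfig M (c ∷ x ∷ [])) (execute P 3 (start P (x ∷ [])))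
  paired-input x = embeds refl Z≗ I≗
    where
    Z≗ : ∀ j → _
    Z≗ zero    = refl
    Z≗ (suc j) = refl
    I≗ : ∀ a → _
    I≗ Fin.zero    = refl
    I≗ (Fin.suc a) = refl

  accepts-singleton : ∀ x → Accepts P (x ∷ []) ⇔ Halts M (c ∷ x ∷ [])
  accepts-singleton x = ⇔-trans (halts-after 3) (⇔-sym (halts-embeds _ _ (paired-input x)))
    where open RunReasoning P

  rejects-longer : ∀ a b bs → ¬ Accepts P (a ∷ b ∷ bs)
  rejects-longer a b bs = diverges-via (reach-if-≢ refl (λ ()) (reach-here (goto-self-diverges refl)))
    where open RunReasoning P

singleton-sdec : {A : Structure} (i : Fin (nConst A)) → SDEC A (idSet A) → SDEC A (singleton A (const A i))
singleton-sdec {A} i (M , M-spec) = compile P , λ x → ⇔-trans (compile-halts P x) (accepts x)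
  where
  open SingletonByPairing M i
  accepts : ∀ x → Accepts P x ⇔ singleton A (const A i) x
  accepts (a ∷ [])     = ⇔-trans (accepts-singleton a)
                           (⇔-trans (M-spec _) (mk⇔ (λ { (_ , refl) → refl }) (λ { refl → _ , refl })))
  accepts (a ∷ b ∷ bs) = mk⇔ (λ halts → ⊥-elim (rejects-longer a b bs halts)) (λ ())

infixr 5 _++[_]_

_++[_]_ : {X : Set} → (ℕ → X) → ℕ → (ℕ → X) → ℕ → X
(f ++[ n ] g) p with p <? n
... | yes _ = f p
... | no  _ = g (p ∸ n)

++-inl : {X : Set} (f g : ℕ → X) (n p : ℕ) → p < n → (f ++[ n ] g) p ≡ f p
++-inl f g n p p<n with p <? n
... | yes _   = refl
... | no  p≮n = ⊥-elim (p≮n p<n)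

++-inr : {X : Set} (f g : ℕ → X) (n q : ℕ) → (f ++[ n ] g) (q + n) ≡ g q
++-inr f g n q with q + n <? n
... | yes q+n<n = ⊥-elim (<⇒≱ q+n<n (m≤n+m n q))
... | no  _     = cong g (m+n∸n≡m q n)

repeat : {X : Set} (S : ℕ) → ℕ → (ℕ → ℕ → X) → (ℕ → X) → ℕ → X
repeat S zero    f after = after
repeat S (suc n) f after = f 0 ++[ S ] repeat S n (λ t → f (suc t)) after

private
  swap-block : ∀ o S X → o + (S + X) ≡ (o + X) + S
  swap-block o S X = begin
    o + (S + X) ≡⟨ +-assoc o S X ⟨
    (o + S) + X ≡⟨ cong (_+ X) (+-comm o S) ⟩
    (S + o) + X ≡⟨ +-assoc S o X ⟩
    S + (o + X) ≡⟨ +-comm S (o + X) ⟩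
    (o + X) + S ∎
    where open ≡-Reasoning

repeat-block : {X : Set} (S n : ℕ) (f : ℕ → ℕ → X) (after : ℕ → X) {t o : ℕ} → t < n → o < S →
               repeat S n f after (o + t * S) ≡ f t o
repeat-block S (suc n) f after {zero}  {o} _ o<S rewrite +-identityʳ o = ++-inl (f 0) _ S o o<S
repeat-block S (suc n) f after {suc t} {o} (s≤s t<n) o<S rewrite swap-block o S (t * S) =
  trans (++-inr (f 0) _ S (o + t * S)) (repeat-block S n (λ t → f (suc t)) after t<n o<S)

repeat-after : {X : Set} (S n : ℕ) (f : ℕ → ℕ → X) (after : ℕ → X) (q : ℕ) →
               repeat S n f after (q + n * S) ≡ after q
repeat-after S zero    f after q rewrite +-identityʳ q = refl
repeat-after S (suc n) f after q rewrite swap-block q S (n * S) =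
  trans (++-inr (f 0) _ S (q + n * S)) (repeat-after S n (λ t → f (suc t)) after q)

double : ℕ → ℕ
double zero    = zero
double (suc n) = suc (suc (double n))

double-injective : ∀ {a b} → double a ≡ double b → a ≡ b
double-injective {zero}  {zero}  _ = refl
double-injective {suc a} {suc b} e = cong suc (double-injective (suc-injective (suc-injective e)))

double≢odd : ∀ a b → double a ≢ suc (double b)
double≢odd (suc zero)    zero    ()
double≢odd (suc (suc a)) zero    ()
double≢odd (suc a)       (suc b) e = double≢odd a b (suc-injective (suc-injective e))

double-≢ : ∀ {a b} → a ≢ b → double a ≢ double b
double-≢ a≢b = a≢b ∘ double-injective

double-≟ : ∀ u v → ⌊ double u ≟ double v ⌋ ≡ ⌊ u ≟ v ⌋
double-≟ u v with double u ≟ double v | u ≟ v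
... | yes _     | yes _    = refl
... | no  _     | no  _    = refl
... | yes du≡dv | no  u≢v  = ⊥-elim (u≢v (double-injective du≡dv))
... | no  du≢dv | yes refl = ⊥-elim (du≢dv refl)

double-+ : ∀ a b → double (a + b) ≡ double a + double b
double-+ zero    b = refl
double-+ (suc a) b = cong (λ x → suc (suc x)) (double-+ a b)

n≤double : ∀ n → n ≤ double n
n≤double zero    = z≤n
n≤double (suc n) = s≤s (m≤n⇒m≤1+n (n≤double n))

inputCell : ℕ → ℕ → ℕ
inputCell m i = double i + (3 + double m)

inputCell-odd : ∀ m i → inputCell m i ≡ suc (double (suc (i + m)))
inputCell-odd m i = begin
  double i + (3 + double m)       ≡⟨ +-suc (double i) (2 + double m) ⟩
  suc (double i + (2 + double m)) ≡⟨ cong suc (+-suc (double i) (1 + double m)) ⟩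
  2 + (double i + (1 + double m)) ≡⟨ cong (2 +_) (+-suc (double i) (double m)) ⟩
  3 + (double i + double m)       ≡⟨ cong (3 +_) (sym (double-+ i m)) ⟩
  3 + double (i + m)              ∎
  where open ≡-Reasoning

double≢inputCell : ∀ r m i → double r ≢ inputCell m i
double≢inputCell r m i e = double≢odd r (suc (i + m)) (trans e (inputCell-odd m i))

1≢inputCell : ∀ m i → 1 ≢ inputCell m i
1≢inputCell m i e with suc-injective (trans e (inputCell-odd m i))
... | ()

1≢double : ∀ r → 1 ≢ double r
1≢double r e = double≢odd r 0 (sym e)

inputCell-injective : ∀ m {i j} → inputCell m i ≡ inputCell m j → i ≡ j
inputCell-injective m e = double-injective (+-cancelʳ-≡ _ _ _ e)

input≢inputCell : ∀ m {j} i → j ≤ m → j ≢ inputCell m i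
input≢inputCell m {j} i j≤m = <⇒≢ (≤-trans (s≤s j≤m) (≤-trans (s≤s m≤2+2m) (m≤n+m (3 + double m) (double i))))
  where
  m≤2+2m : m ≤ 2 + double m
  m≤2+2m = ≤-trans (n≤double m) (m≤n+m (double m) 2)

module Layout {X : Set} (code : ℕ → X) where

  Placed : ℕ → (ℕ → X) → Set
  Placed b f = ∀ p → code (p + b) ≡ f p

  placed-inl : ∀ {b n f g p} → Placed b (f ++[ n ] g) → p < n → code (p + b) ≡ f p
  placed-inl {b} {n} {f} {g} {p} placed p<n = trans (placed p) (++-inl f g n p p<n)

  placed-inr : ∀ {b n f g} → Placed b (f ++[ n ] g) → Placed (n + b) g
  placed-inr {b} {n} {f} {g} placed q =
    trans (cong code (sym (+-assoc q n b))) (trans (placed (q + n)) (++-inr f g n q))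

  placed-block : ∀ {b S n f after t o} → Placed b (repeat S n f after) → t < n → o < S →
                 code ((o + t * S) + b) ≡ f t o
  placed-block {S = S} {n} {f} {after} placed t<n o<S = trans (placed _) (repeat-block S n f after t<n o<S)

  placed-after : ∀ {b S n f after} → Placed b (repeat S n f after) → Placed (n * S + b) after
  placed-after {b} {S} {n} {f} {after} placed q =
    trans (cong code (sym (+-assoc q (n * S) b))) (trans (placed (q + n * S)) (repeat-after S n f after q))

-- Simulating a machine for a bounded number of steps

-- last is I₁ and holds m = n - 1; elem holds the index e of the current element x,
-- cursor the cell inputCell m e of its copy, top twice the high-water mark.
module Registers (KK : ℕ) where

  Reg : Set
  Reg = Fin (9 + KK)

  last clock budget top scratch cursor elem src dst : Reg
  last    = # 0
  clock   = # 1
  budget  = # 2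
  top     = # 3
  scratch = # 4
  cursor  = # 5
  elem    = # 6
  src     = # 7
  dst     = # 8

  simReg : Fin KK → Reg
  simReg a = 9 ↑ʳ a

  -- A product rather than a record, so that it is kept definitionally by
  -- updates of the other index registers.
  Counters : (Reg → ℕ) → ℕ → ℕ → ℕ → Set
  Counters Is m e bud = Is last ≡ m × Is elem ≡ e × Is cursor ≡ inputCell m e × Is budget ≡ bud

  Counters-budget : ∀ Is {m e bud} → Counters Is m e bud → Is budget ≡ bud
  Counters-budget Is (_ , _ , _ , budget≡) = budget≡

  InputCopied : {Y : Set} → (ℕ → Y) → ℕ → (ℕ → Y) → Set
  InputCopied Zs m X0 = ∀ i → i ≤ m → Zs (inputCell m i) ≡ X0 i

vecBound : ∀ {n} → Vec ℕ n → ℕ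
vecBound []       = 0
vecBound (j ∷ js) = suc j ⊔ vecBound js

regBound : {A : Structure} {k L : ℕ} → Instr A k L → ℕ
regBound (opI j i js)        = suc j ⊔ vecBound js
regBound (constI j i)        = suc j
regBound (copyI j j')        = suc j ⊔ suc j'
regBound (relBrI i js l₁ l₂) = vecBound js
regBound _                   = 0

progRegBound : {A : Structure} {k L' : ℕ} (L : ℕ) → (Fin (suc L) → Instr A k L') → ℕ
progRegBound zero    f = regBound (f Fin.zero)
progRegBound (suc L) f = regBound (f Fin.zero) ⊔ progRegBound L (λ ℓ → f (Fin.suc ℓ))

regBound≤progRegBound : {A : Structure} {k L' : ℕ} (L : ℕ) (f : Fin (suc L) → Instr A k L') →
                        ∀ ℓ → regBound (f ℓ) ≤ progRegBound L f
regBound≤progRegBound zero    f Fin.zero    = ≤-refl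
regBound≤progRegBound (suc L) f Fin.zero    = m≤m⊔n _ _
regBound≤progRegBound (suc L) f (Fin.suc ℓ) =
  ≤-trans (regBound≤progRegBound L (λ ℓ → f (Fin.suc ℓ)) ℓ) (m≤n⊔m _ _)

module TrialSize {A : Structure} (M : Machine A) (b : ℕ) where

  KM LM D : ℕ
  KM = suc (nIdx M)
  LM = nLab M
  D  = suc (progRegBound LM (prog M))

  initBase resetBase clockBase blocksBase : ℕ
  initBase   = 4 + b
  resetBase  = D * 3 + initBase
  clockBase  = KM * 1 + resetBase
  blocksBase = 1 + clockBase

  blockStart : ℕ → ℕ
  blockStart t = t * 11 + blocksBase

  trialEnd : ℕ
  trialEnd = suc LM * 11 + blocksBase

module TrialCode (A : Structure) (KK : ℕ) (M : Machine A) (g : Fin (suc (nIdx M)) → Fin KK)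
                 (b accept timeout : ℕ) where

  open Registers KK public

  open TrialSize M b public

  Ins : Set
  Ins = Cmd A (9 + KK)

  mReg : Fin KM → Reg
  mReg a = simReg (g a)

  mRegℕ : ℕ → Reg
  mRegℕ a with a <? KM
  ... | yes a<KM = mReg (fromℕ< a<KM)
  ... | no  _    = last

  setup : ℕ → Ins
  setup 0 = indOneC scratch
  setup 1 = indIncC scratch
  setup 2 = indCopyC scratch cursor
  setup _ = indOneC top

  initReg : ℕ → ℕ → Ins
  initReg d 0 = copyC (double d) 1
  initReg d _ = indIncC top

  resetIdx : ℕ → ℕ → Ins
  resetIdx a _ = indOneC (mRegℕ a)

  -- After raising I_a, if it has reached the high-water mark the register at top is
  -- initialised with x, which register 1 holds, and the mark is raised.
  body : ℕ → Instr A KM (suc LM) → ℕ → Ins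
  body t (opI j i js)        0 = opC (double j) i (map double js)
  body t (constI j i)        0 = constC (double j) i
  body t (copyI j j')        0 = copyC (double j) (double j')
  body t (indCopyI a c)      0 = indCopyC (mReg a) (mReg c)
  body t (indOneI a)         0 = indOneC (mReg a)
  body t (indIncI a)         0 = indIncC (mReg a)
  body t (indIncI a)         1 = indIncC (mReg a)
  body t (indIncI a)         2 = indBrC (mReg a) top (5 + blockStart t) (blockStart (suc t))
  body t (indIncI a)         3 = indOneC scratch
  body t (indIncI a)         4 = indIncC scratch
  body t (indIncI a)         5 = indCopyC top scratch
  body t (indIncI a)         6 = indIncC top
  body t (indIncI a)         7 = indIncC top
  body t (indIncI a)         8 = goto (blockStart (suc t))
  body t (relBrI i js l₁ l₂) 0 = relBrC i (map double js) (blockStart (toℕ l₁)) (blockStart (toℕ l₂))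
  body t (indBrI a c l₁ l₂)  0 = indBrC (mReg a) (mReg c) (blockStart (toℕ l₁)) (blockStart (toℕ l₂))
  body t _                   1 = goto (blockStart (suc t))
  body t _                   _ = stopC

  block : ℕ → Instr A KM (suc LM) → ℕ → Ins
  block t stopI 0             = goto accept
  block t stopI _             = stopC
  block t ins   0             = indBrC clock budget timeout (1 + blockStart t)
  block t ins   1             = indIncC clock
  block t ins   (suc (suc o)) = body t ins o

  blocksCode clockCode resetCode initCode trialCode : (ℕ → Ins) → ℕ → Ins
  blocksCode rest = repeat 11 (suc LM) (λ t → block t (progℕ M t)) rest
  clockCode  rest = (λ _ → indOneC clock) ++[ 1 ] blocksCode rest
  resetCode  rest = repeat 1 KM resetIdx (clockCode rest)
  initCode   rest = repeat 3 D initReg (resetCode rest)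
  trialCode  rest = setup ++[ 4 ] initCode rest

module TrialPlacement (A : Structure) (KK : ℕ) (M : Machine A) (g : Fin (suc (nIdx M)) → Fin KK)
                      (b accept timeout : ℕ) (code : ℕ → Cmd A (9 + KK)) (rest : ℕ → Cmd A (9 + KK))
                      (placed : Layout.Placed code b (TrialCode.trialCode A KK M g b accept timeout rest)) where

  open TrialCode A KK M g b accept timeout public
  open Layout code

  placed-init : Placed initBase (initCode rest)
  placed-init = placed-inr {f = setup} placed

  placed-reset : Placed resetBase (resetCode rest)
  placed-reset = placed-after {S = 3} {D} {initReg} placed-init

  placed-clock : Placed clockBase (clockCode rest)
  placed-clock = placed-after {S = 1} {KM} {resetIdx} placed-reset

  placed-blocks : Placed blocksBase (blocksCode rest)
  placed-blocks = placed-inr {n = 1} {λ _ → indOneC clock} placed-clock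

  placed-rest : Placed trialEnd rest
  placed-rest = placed-after {S = 11} {suc LM} {λ t → block t (progℕ M t)} placed-blocks

  at-init : ∀ {d} o → d < D → o < 3 → code ((o + d * 3) + initBase) ≡ initReg d o
  at-init o d<D o<3 = placed-block {S = 3} {D} {initReg} placed-init d<D o<3

  at-reset : ∀ {a} → a < KM → code (a * 1 + resetBase) ≡ indOneC (mRegℕ a)
  at-reset a<KM = placed-block {S = 1} {KM} {resetIdx} placed-reset a<KM (s≤s z≤n)

  at-clock : code clockBase ≡ indOneC clock
  at-clock = placed-inl {n = 1} {λ _ → indOneC clock} placed-clock (s≤s z≤n)

  at-block : ∀ {ℓ ins} o {_ : True (o <? 11)} → prog M ℓ ≡ ins →
             code ((o + toℕ ℓ * 11) + blocksBase) ≡ block (toℕ ℓ) ins o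
  at-block {ℓ} o {o<11} ins≡ =
    trans (placed-block {S = 11} {suc LM} {λ t → block t (progℕ M t)} placed-blocks (toℕ<n ℓ) (toWitness o<11))
          (cong (λ ins → block (toℕ ℓ) ins o) (trans (progℕ-toℕ M ℓ) ins≡))

module TrialRun (A : Structure) (KK : ℕ) (M : Machine A) (g : Fin (suc (nIdx M)) → Fin KK)
                (g-injective : Injective _≡_ _≡_ g) (b accept timeout : ℕ)
                (L : ℕ) (code : ℕ → Cmd A (9 + KK)) (code-beyond : ∀ p → L ≤ p → code p ≡ stopC)
                (rest : ℕ → Cmd A (9 + KK))
                (placed : Layout.Placed code b (TrialCode.trialCode A KK M g b accept timeout rest)) where

  open TrialPlacement A KK M g b accept timeout code rest placed public

  N : Program A
  N = program (8 + KK) L code code-beyond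

  open RunReasoning N

  mReg-injective : Injective _≡_ _≡_ mReg
  mReg-injective e = g-injective (↑ʳ-injective 9 _ _ e)

  mRegℕ-toℕ : ∀ a (a<KM : a < KM) → mRegℕ a ≡ mReg (fromℕ< a<KM)
  mRegℕ-toℕ a a<KM with a <? KM
  ... | yes _    = refl
  ... | no  a≮KM = ⊥-elim (a≮KM a<KM)

  copied-upd : ∀ {Zs : ℕ → U A} {m X0} j v → (∀ i → j ≢ inputCell m i) →
               InputCopied Zs m X0 → InputCopied (updZ Zs j v) m X0
  copied-upd {Zs} {m} j v j≢cell copied i i≤m =
    trans (updZ-other Zs j v (inputCell m i) (j≢cell i ∘ sym)) (copied i i≤m)

  module Attempt (X0 : ℕ → U A) (m e bud : ℕ) (e≤m : e ≤ m) where

    x : U A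
    x = X0 e

    mrun : ℕ → Config A KM (suc LM)
    mrun t = run M t (initConfig M (x ∷ []))

    StoppedAt : ℕ → Set
    StoppedAt = StopsAfter M (initConfig M (x ∷ []))

    record Mem (Zd Zm : ℕ → U A) (th : ℕ) : Set where
      constructor mem
      field
        below  : ∀ r → r < th → Zd (double r) ≡ Zm r
        above  : ∀ r → th ≤ r → Zm r ≡ x
        x-at-1 : Zd 1 ≡ x
        copied : InputCopied Zd m X0

    mem-write : ∀ {Zd Zm th} → Mem Zd Zm th → ∀ j {v v'} → j < th → v ≡ v' →
                Mem (updZ Zd (double j) v) (updZ Zm j v') th
    mem-write {Zd} {Zm} {th} (mem below above x-at-1 copied) j {v} {v'} j<th refl =
      mem below' above' (trans (updZ-other Zd (double j) v 1 (1≢double j)) x-at-1)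
          (copied-upd {Zd} (double j) v (double≢inputCell j m) copied)
      where
      below' : ∀ r → r < th → updZ Zd (double j) v (double r) ≡ updZ Zm j v r
      below' r r<th with r ≟ j
      ... | yes refl = updZ-same Zd (double r) v
      ... | no  r≢j  = trans (updZ-other Zd (double j) v (double r) (double-≢ r≢j)) (below r r<th)
      above' : ∀ r → th ≤ r → updZ Zm j v r ≡ x
      above' r th≤r = trans (updZ-other Zm j v r (<⇒≢ (<-≤-trans j<th th≤r) ∘ sym)) (above r th≤r)

    mem-grow : ∀ {Zd Zm th} → Mem Zd Zm th → Mem (updZ Zd (double th) (Zd 1)) Zm (suc th)
    mem-grow {Zd} {Zm} {th} (mem below above x-at-1 copied) =
      mem below' (λ r th<r → above r (≤-trans (n≤1+n th) th<r))
          (trans (updZ-other Zd (double th) (Zd 1) 1 (1≢double th)) x-at-1)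
          (copied-upd {Zd} (double th) (Zd 1) (double≢inputCell th m) copied)
      where
      below' : ∀ r → r < suc th → updZ Zd (double th) (Zd 1) (double r) ≡ Zm r
      below' r r<1+th with m≤n⇒m<n∨m≡n (≤-pred r<1+th)
      ... | inj₁ r<th = trans (updZ-other Zd (double th) (Zd 1) (double r) (double-≢ (<⇒≢ r<th))) (below r r<th)
      ... | inj₂ refl = trans (updZ-same Zd (double r) (Zd 1)) (trans x-at-1 (sym (above r ≤-refl)))

    record Simulates (mc : Config A KM (suc LM)) (d : StateOf N) (s : ℕ) : Set where
      constructor simulates
      field
        in-block : pc d ≡ blockStart (toℕ (label mc))
        clock≡   : Ir d clock ≡ s
        idx≡     : ∀ a → Ir d (mReg a) ≡ double (I mc a)
        th       : ℕ
        top≡     : Ir d top ≡ double th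
        idx<th   : ∀ a → I mc a < th
        D≤th     : D ≤ th
        memory   : Mem (Zr d) (Z mc) th
        counted  : Counters (Ir d) m e bud

    record Prepared (Zs : ℕ → U A) (Is : Reg → ℕ) (j : ℕ) : Set where
      constructor prepared
      field
        top≡        : Is top ≡ double j
        counted     : Counters Is m e bud
        copied      : InputCopied Zs m X0
        x-at-1      : Zs 1 ≡ x
        initialised : ∀ q → q < j → Zs (double q) ≡ x

    init-loop : ∀ r j Zs Is → r + j ≡ D → Prepared Zs Is j →
                Reach N ⟨ j * 3 + initBase , Zs , Is ⟩ (λ d → pc d ≡ resetBase × Prepared (Zr d) (Ir d) D)
    init-loop zero    j Zs Is refl prep = reach-here (refl , prep)
    init-loop (suc r) j Zs Is r+j≡D (prepared top≡ counted copied x-at-1 initialised) =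
      reach-cmd (at-init 0 j<D (s≤s z≤n)) (reach-cmd (at-init 1 j<D (s≤s (s≤s z≤n)))
        (reach-cmd (at-init 2 j<D (s≤s (s≤s (s≤s z≤n))))
          (init-loop r (suc j) Zs' _ (trans (+-suc r j) r+j≡D)
            (prepared (cong (λ n → suc (suc n)) top≡) counted
              (copied-upd {Zs} (double j) (Zs 1) (double≢inputCell j m) copied)
              (trans (updZ-other Zs (double j) (Zs 1) 1 (1≢double j)) x-at-1) initialised'))))
      where
      j<D : j < D
      j<D = subst (j <_) r+j≡D (m<n+m j (s≤s z≤n))
      Zs' : ℕ → U A
      Zs' = updZ Zs (double j) (Zs 1)
      initialised' : ∀ q → q < suc j → Zs' (double q) ≡ x
      initialised' q q<1+j with m≤n⇒m<n∨m≡n (≤-pred q<1+j)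
      ... | inj₁ q<j = trans (updZ-other Zs (double j) (Zs 1) (double q) (double-≢ (<⇒≢ q<j))) (initialised q q<j)
      ... | inj₂ refl = trans (updZ-same Zs (double q) (Zs 1)) x-at-1

    Reset : StateOf N → Set
    Reset d = pc d ≡ clockBase × Prepared (Zr d) (Ir d) D × (∀ c → Ir d (mReg c) ≡ 0)

    reset-loop : ∀ r a Zs Is → r + a ≡ KM → Prepared Zs Is D → (∀ c → toℕ c < a → Is (mReg c) ≡ 0) →
                 Reach N ⟨ a * 1 + resetBase , Zs , Is ⟩ Reset
    reset-loop zero    a Zs Is refl prep reset = reach-here (refl , prep , λ c → reset c (toℕ<n c))
    reset-loop (suc r) a Zs Is r+a≡KM (prepared top≡ counted copied x-at-1 initialised) reset =
      reach-cmd (trans (at-reset a<KM) (cong indOneC (mRegℕ-toℕ a a<KM)))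
        (reset-loop r (suc a) Zs _ (trans (+-suc r a) r+a≡KM)
          (prepared top≡ counted copied x-at-1 initialised) reset')
      where
      a<KM : a < KM
      a<KM = subst (a <_) r+a≡KM (m<n+m a (s≤s z≤n))
      reset' : ∀ c → toℕ c < suc a → updI Is (mReg (fromℕ< a<KM)) 0 (mReg c) ≡ 0
      reset' c c<1+a with m≤n⇒m<n∨m≡n (≤-pred c<1+a)
      ... | inj₁ c<a = trans (updI-other Is _ 0 (mReg c)
                               (λ e → <⇒≢ c<a (trans (cong toℕ (mReg-injective e)) (toℕ-fromℕ< a<KM)))) (reset c c<a)
      ... | inj₂ c≡a rewrite toℕ-injective {i = c} {j = fromℕ< a<KM} (trans c≡a (sym (toℕ-fromℕ< a<KM))) =
                               updI-same Is (mReg (fromℕ< a<KM)) 0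

    start-simulation : ∀ Zs Is → Prepared Zs Is D → (∀ c → Is (mReg c) ≡ 0) →
                       Simulates (mrun 0) ⟨ blocksBase , Zs , updI Is clock 0 ⟩ 0
    start-simulation Zs Is (prepared top≡ counted copied x-at-1 initialised) reset =
      simulates refl refl idx≡ D top≡ idx<D ≤-refl (mem initialised (λ _ _ → refl) x-at-1 copied) counted
      where
      idx≡ : ∀ a → Is (mReg a) ≡ double (initI 1 a)
      idx≡ Fin.zero    = reset Fin.zero
      idx≡ (Fin.suc a) = reset (Fin.suc a)
      idx<D : ∀ a → initI 1 a < D
      idx<D Fin.zero    = s≤s z≤n
      idx<D (Fin.suc a) = s≤s z≤n

    setup-phase : ∀ Zs Is → Counters Is m e bud → InputCopied Zs m X0 →
                  Reach N ⟨ b , Zs , Is ⟩ (λ d → Simulates (mrun 0) d 0)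
    setup-phase Zs Is counted@(_ , _ , cursor≡ , _) copied =
      reach-cmd (placed 0) (reach-cmd (placed 1) (reach-cmd (placed 2) (reach-cmd (placed 3)
        (reach-bind (init-loop D 0 _ _ (+-identityʳ D) prepared₀) after-init))))
      where
      x-at-1 : updZ Zs 1 (Zs (Is cursor)) 1 ≡ x
      x-at-1 = trans (updZ-same Zs 1 _) (trans (cong Zs cursor≡) (copied e e≤m))
      prepared₀ = prepared refl counted (copied-upd {Zs} 1 (Zs (Is cursor)) (1≢inputCell m) copied) x-at-1 (λ _ ())
      after-reset : ∀ d → Reset d → Reach N d (λ d → Simulates (mrun 0) d 0)
      after-reset ⟨ _ , Zs , Is ⟩ (refl , prep , reset) =
        reach-cmd at-clock (reach-here (start-simulation Zs Is prep reset))
      after-init : ∀ d → pc d ≡ resetBase × Prepared (Zr d) (Ir d) D →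
                   Reach N d (λ d → Simulates (mrun 0) d 0)
      after-init ⟨ _ , Zs , Is ⟩ (refl , prep) =
        reach-bind (reset-loop KM 0 Zs Is (+-identityʳ KM) prep (λ _ ())) after-reset

    open Simulates

    tick : (Reg → ℕ) → Reg → ℕ
    tick Is = updI Is clock (suc (Is clock))

    block-entry : ∀ t ins → ins ≢ stopI →
                  block t ins 0 ≡ indBrC clock budget timeout (1 + blockStart t) × block t ins 1 ≡ indIncC clock
    block-entry t (opI _ _ _)      _ = refl , refl
    block-entry t (constI _ _)     _ = refl , refl
    block-entry t (copyI _ _)      _ = refl , refl
    block-entry t (indCopyI _ _)   _ = refl , refl
    block-entry t (indOneI _)      _ = refl , refl
    block-entry t (indIncI _)      _ = refl , refl
    block-entry t (relBrI _ _ _ _) _ = refl , refl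
    block-entry t (indBrI _ _ _ _) _ = refl , refl
    block-entry t stopI ¬stop = ⊥-elim (¬stop refl)

    next-block : ∀ {ℓ ins} → prog M ℓ ≡ ins → ins ≢ stopI →
                 blockStart (suc (toℕ ℓ)) ≡ blockStart (toℕ (nextLabel ℓ))
    next-block {ℓ} ins≡ ¬stop =
      cong blockStart (sym (toℕ-nextLabel ℓ (label<nLab M ℓ (¬stop ∘ trans (sym ins≡)))))

    regBound≤th : ∀ {ℓ Zm Im d s ins} (sim : Simulates (config ℓ Zm Im) d s) → prog M ℓ ≡ ins →
                  regBound ins ≤ th sim
    regBound≤th {ℓ} sim refl =
      ≤-trans (regBound≤progRegBound LM (prog M) ℓ) (≤-trans (n≤1+n _) (D≤th sim))

    map-double : ∀ {n} {Zd Zm : ℕ → U A} {th} → Mem Zd Zm th → (js : Vec ℕ n) → vecBound js ≤ th →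
                 map Zd (map double js) ≡ map Zm js
    map-double mm []       _     = refl
    map-double mm (j ∷ js) js≤th =
      cong₂ _∷_ (Mem.below mm j (m⊔n≤o⇒m≤o (suc j) (vecBound js) js≤th))
                (map-double mm js (m⊔n≤o⇒n≤o (suc j) (vecBound js) js≤th))

    idx-upd : ∀ {Id : Reg → ℕ} {Im : Fin KM → ℕ} → (∀ c → Id (mReg c) ≡ double (Im c)) →
              ∀ a {v u} → v ≡ double u → ∀ c → updI Id (mReg a) v (mReg c) ≡ double (updI Im a u c)
    idx-upd {Id} idx≡ a {v} v≡ c rewrite updI-∘ mReg mReg-injective Id a v c with c Fin.≟ a
    ... | yes _ = v≡
    ... | no  _ = idx≡ c

    module _ {ℓ : Fin (suc LM)} {Zm : ℕ → U A} {Im : Fin KM → ℕ} {Zd : ℕ → U A} {Id : Reg → ℕ} {s : ℕ}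
             (sim : Simulates (config ℓ Zm Im) ⟨ blockStart (toℕ ℓ) , Zd , Id ⟩ s) (s<bud : s < bud) where

      private
        t = toℕ ℓ

      Stepped : Instr A KM (suc LM) → StateOf N → Set
      Stepped ins d = Simulates (stepInstr M ins ℓ Zm Im) d (suc s)

      Simulated : Instr A KM (suc LM) → Set
      Simulated ins = Reach N ⟨ blockStart t , Zd , Id ⟩ (Stepped ins)

      enter : ∀ {ins Q} → prog M ℓ ≡ ins → ins ≢ stopI →
              Reach N ⟨ 2 + blockStart t , Zd , tick Id ⟩ Q → Reach N ⟨ blockStart t , Zd , Id ⟩ Q
      enter {ins} ins≡ ¬stop r =
        reach-if-≢ (trans (at-block 0 ins≡) (proj₁ entry)) clock≢budget
          (reach-cmd (trans (at-block 1 ins≡) (proj₂ entry)) r)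
        where
        entry = block-entry t ins ¬stop
        clock≢budget : Id clock ≢ Id budget
        clock≢budget c≡b =
          <⇒≢ s<bud (trans (sym (clock≡ sim)) (trans c≡b (Counters-budget Id (counted sim))))

      indices-kept : ∀ {ℓ' p Zm' Zd'} → p ≡ blockStart (toℕ ℓ') → Mem Zd' Zm' (th sim) →
                     Simulates (config ℓ' Zm' Im) ⟨ p , Zd' , tick Id ⟩ (suc s)
      indices-kept p≡ mm =
        simulates p≡ (cong suc (clock≡ sim)) (idx≡ sim) (th sim) (top≡ sim) (idx<th sim) (D≤th sim) mm (counted sim)

      sim-op : ∀ {j i js} → prog M ℓ ≡ opI j i js → Simulated (opI j i js)
      sim-op {j} {i} {js} ins≡ =
        enter ins≡ (λ ())
          (reach-cmd (at-block 2 ins≡) (reach-goto (at-block 3 ins≡) (reach-here (indices-kept (next-block ins≡ (λ ()))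
            (mem-write (memory sim) j (m⊔n≤o⇒m≤o (suc j) (vecBound js) bound)
              (cong (op A i) (map-double (memory sim) js (m⊔n≤o⇒n≤o (suc j) (vecBound js) bound))))))))
        where
        bound = regBound≤th sim ins≡

      sim-const : ∀ {j i} → prog M ℓ ≡ constI j i → Simulated (constI j i)
      sim-const {j} ins≡ =
        enter ins≡ (λ ())
          (reach-cmd (at-block 2 ins≡) (reach-goto (at-block 3 ins≡) (reach-here (indices-kept (next-block ins≡ (λ ()))
            (mem-write (memory sim) j (regBound≤th sim ins≡) refl)))))

      sim-copy : ∀ {j j'} → prog M ℓ ≡ copyI j j' → Simulated (copyI j j')
      sim-copy {j} {j'} ins≡ =
        enter ins≡ (λ ())
          (reach-cmd (at-block 2 ins≡) (reach-goto (at-block 3 ins≡) (reach-here (indices-kept (next-block ins≡ (λ ()))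
            (mem-write (memory sim) j (m⊔n≤o⇒m≤o (suc j) (suc j') bound)
              (Mem.below (memory sim) j' (m⊔n≤o⇒n≤o (suc j) (suc j') bound)))))))
        where
        bound = regBound≤th sim ins≡

      sim-indCopy : ∀ {a c} → prog M ℓ ≡ indCopyI a c → Simulated (indCopyI a c)
      sim-indCopy {a} {c} ins≡ =
        enter ins≡ (λ ())
          (reach-cmd (at-block 2 ins≡) (reach-goto (at-block 3 ins≡) (reach-here (indices-kept (next-block ins≡ (λ ()))
            (subst (λ r → Mem (updZ Zd r (Zd (Id (mReg c)))) _ (th sim)) (sym (idx≡ sim a))
              (mem-write (memory sim) (Im a) (idx<th sim a)
                (trans (cong Zd (idx≡ sim c)) (Mem.below (memory sim) (Im c) (idx<th sim c)))))))))

      sim-indOne : ∀ {a} → prog M ℓ ≡ indOneI a → Simulated (indOneI a)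
      sim-indOne {a} ins≡ =
        enter ins≡ (λ ())
          (reach-cmd (at-block 2 ins≡) (reach-goto (at-block 3 ins≡) (reach-here
            (simulates (next-block ins≡ (λ ())) (cong suc (clock≡ sim)) (idx-upd {tick Id} (idx≡ sim) a refl)
              (th sim) (top≡ sim) idx<th' (D≤th sim) (memory sim) (counted sim)))))
        where
        idx<th' : ∀ c → updI Im a 0 c < th sim
        idx<th' c with c Fin.≟ a
        ... | yes _ = ≤-trans (s≤s z≤n) (D≤th sim)
        ... | no  _ = idx<th sim c

      sim-indInc : ∀ {a} → prog M ℓ ≡ indIncI a → Simulated (indIncI a)
      sim-indInc {a} ins≡ =
        enter ins≡ (λ ())
          (reach-cmd (at-block 2 ins≡) (reach-cmd (at-block 3 ins≡) (compare (suc (Im a) ≟ th sim))))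
        where
        Id₁ Id₂ : Reg → ℕ
        Id₁ = tick Id
        Id₂ = updI Id₁ (mReg a) (suc (Id₁ (mReg a)))
        Im' : Fin KM → ℕ
        Im' = updI Im a (suc (Im a))
        idx≡' : ∀ c → updI Id₂ (mReg a) (suc (Id₂ (mReg a))) (mReg c) ≡ double (Im' c)
        idx≡' c = trans (updI-twice Id₁ (mReg a) _ _ (mReg c)) (idx-upd {Id₁} (idx≡ sim) a twice-bumped c)
          where
          twice-bumped : suc (Id₂ (mReg a)) ≡ double (suc (Im a))
          twice-bumped = cong suc (trans (updI-same Id₁ (mReg a) _) (cong suc (idx≡ sim a)))
        bumped : updI Id₂ (mReg a) (suc (Id₂ (mReg a))) (mReg a) ≡ double (suc (Im a))
        bumped = trans (idx≡' a) (cong double (updI-same Im a _))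
        compare : Dec (suc (Im a) ≡ th sim) →
                  Reach N ⟨ 4 + blockStart t , Zd , updI Id₂ (mReg a) (suc (Id₂ (mReg a))) ⟩
                        (Stepped (indIncI a))
        compare (yes grows) =
          reach-if-≡ (at-block 4 ins≡) (trans bumped (trans (cong double grows) (sym (top≡ sim))))
            (reach-cmd (at-block 5 ins≡) (reach-cmd (at-block 6 ins≡) (reach-cmd (at-block 7 ins≡)
              (reach-cmd (at-block 8 ins≡) (reach-cmd (at-block 9 ins≡) (reach-goto (at-block 10 ins≡) (reach-here
                (simulates (next-block ins≡ (λ ())) (cong suc (clock≡ sim)) idx≡' (suc (th sim))
                  (cong (λ n → suc (suc n)) (top≡ sim)) idx<th' (≤-trans (D≤th sim) (n≤1+n _))
                  (subst (λ r → Mem (updZ Zd r (Zd 1)) Zm (suc (th sim))) (sym (top≡ sim)) (mem-grow (memory sim)))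
                  (counted sim)))))))))
          where
          idx<th' : ∀ c → Im' c < suc (th sim)
          idx<th' c with c Fin.≟ a
          ... | yes _ = s≤s (idx<th sim a)
          ... | no  _ = m≤n⇒m≤1+n (idx<th sim c)
        compare (no stays) =
          reach-if-≢ (at-block 4 ins≡) (stays ∘ double-injective ∘ λ eq → trans (sym bumped) (trans eq (top≡ sim)))
            (reach-here (simulates (next-block ins≡ (λ ())) (cong suc (clock≡ sim)) idx≡' (th sim) (top≡ sim)
              idx<th' (D≤th sim) (memory sim) (counted sim)))
          where
          idx<th' : ∀ c → Im' c < th sim
          idx<th' c with c Fin.≟ a
          ... | yes _ = ≤∧≢⇒< (idx<th sim a) stays
          ... | no  _ = idx<th sim c

      sim-relBr : ∀ {i js l₁ l₂} → prog M ℓ ≡ relBrI i js l₁ l₂ → Simulated (relBrI i js l₁ l₂)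
      sim-relBr {i} {js} {l₁} {l₂} ins≡ =
        enter ins≡ (λ ())
          (reach-cmd (at-block 2 ins≡) (reach-here (indices-kept target (memory sim))))
        where
        target : (if rel A i (map Zd (map double js)) then blockStart (toℕ l₁) else blockStart (toℕ l₂))
                 ≡ blockStart (toℕ (if rel A i (map Zm js) then l₁ else l₂))
        target rewrite map-double (memory sim) js (regBound≤th sim ins≡) =
          sym (if-float (blockStart ∘ toℕ) (rel A i (map Zm js)))

      sim-indBr : ∀ {a c l₁ l₂} → prog M ℓ ≡ indBrI a c l₁ l₂ → Simulated (indBrI a c l₁ l₂)
      sim-indBr {a} {c} {l₁} {l₂} ins≡ =
        enter ins≡ (λ ())
          (reach-cmd (at-block 2 ins≡) (reach-here (indices-kept target (memory sim))))
        where
        target : (if ⌊ Id (mReg a) ≟ Id (mReg c) ⌋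
                    then blockStart (toℕ l₁) else blockStart (toℕ l₂))
                 ≡ blockStart (toℕ (if ⌊ Im a ≟ Im c ⌋ then l₁ else l₂))
        target rewrite idx≡ sim a | idx≡ sim c | double-≟ (Im a) (Im c) =
          sym (if-float (blockStart ∘ toℕ) ⌊ Im a ≟ Im c ⌋)

    sim-step : ∀ {mc d s} → Simulates mc d s → s < bud → prog M (label mc) ≢ stopI →
               Reach N d (λ d' → Simulates (step M mc) d' (suc s))
    sim-step {config ℓ Zm Im} {⟨ p , Zd , Id ⟩} {s} sim s<bud ¬stop with in-block sim
    ... | refl rewrite step≡stepInstr M ℓ Zm Im with prog M ℓ in ins≡
    ... | opI _ _ _      = sim-op      sim s<bud ins≡
    ... | constI _ _     = sim-const   sim s<bud ins≡
    ... | copyI _ _      = sim-copy    sim s<bud ins≡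
    ... | indCopyI _ _   = sim-indCopy sim s<bud ins≡
    ... | indOneI _      = sim-indOne  sim s<bud ins≡
    ... | indIncI _      = sim-indInc  sim s<bud ins≡
    ... | relBrI _ _ _ _ = sim-relBr   sim s<bud ins≡
    ... | indBrI _ _ _ _ = sim-indBr   sim s<bud ins≡
    ... | stopI          = ⊥-elim (¬stop refl)

    Outcome : StateOf N → Set
    Outcome d = Counters (Ir d) m e bud × InputCopied (Zr d) m X0 ×
                ((pc d ≡ accept × StoppedAt bud) ⊎ (pc d ≡ timeout × ¬ StoppedAt bud))

    stopI? : ∀ {k L'} (ins : Instr A k L') → Dec (ins ≡ stopI)
    stopI? stopI            = yes refl
    stopI? (opI _ _ _)      = no λ ()
    stopI? (constI _ _)     = no λ ()
    stopI? (copyI _ _)      = no λ ()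
    stopI? (indCopyI _ _)   = no λ ()
    stopI? (indOneI _)      = no λ ()
    stopI? (indIncI _)      = no λ ()
    stopI? (relBrI _ _ _ _) = no λ ()
    stopI? (indBrI _ _ _ _) = no λ ()

    simulate : ∀ r s d → r + s ≡ bud → Simulates (mrun s) d s → Reach N d Outcome
    simulate r s ⟨ p , Zd , Id ⟩ r+s≡bud sim with in-block sim | stopI? (prog M (label (mrun s)))
    ... | refl | yes stop =
      reach-goto (at-block 0 stop)
        (reach-here (counted sim , Mem.copied (memory sim) , inj₁ (refl , stopsAfter-mono M _ s≤bud stop)))
      where
      s≤bud : s ≤ bud
      s≤bud = subst (s ≤_) r+s≡bud (m≤n+m s r)
    ... | refl | no ¬stop = running r r+s≡bud
      where
      ℓ = label (mrun s)
      running : ∀ r → r + s ≡ bud → Reach N ⟨ blockStart (toℕ ℓ) , Zd , Id ⟩ Outcome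
      running zero refl =
        reach-if-≡ (trans (at-block 0 refl) (proj₁ (block-entry (toℕ ℓ) (prog M ℓ) ¬stop)))
          (trans (clock≡ sim) (sym (Counters-budget Id (counted sim))))
          (reach-here (counted sim , Mem.copied (memory sim) , inj₂ (refl , ¬stop)))
      running (suc r) r+s≡bud =
        reach-bind (sim-step sim (subst (s <_) r+s≡bud (m<n+m s (s≤s z≤n))) ¬stop) λ d' sim' →
          simulate r (suc s) d' (trans (+-suc r s) r+s≡bud)
            (subst (λ mc → Simulates mc d' (suc s)) (sym (run-suc M s (initConfig M (x ∷ [])))) sim')

    trial : ∀ Zs Is → Counters Is m e bud → InputCopied Zs m X0 → Reach N ⟨ b , Zs , Is ⟩ Outcome
    trial Zs Is counted copied =
      reach-bind (setup-phase Zs Is counted copied) λ d sim → simulate bud 0 d (+-identityʳ bud) sim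

-- Dovetailing the semi-deciders of {c₁} and {c₂}

module PairStar (A : Structure) (M₁ M₂ : Machine A) where

  K₁ K₂ KK : ℕ
  K₁ = suc (nIdx M₁)
  K₂ = suc (nIdx M₂)
  KK = K₁ + K₂

  g₁ : Fin K₁ → Fin KK
  g₁ a = a ↑ˡ K₂

  g₂ : Fin K₂ → Fin KK
  g₂ a = K₁ ↑ʳ a

  open Registers KK

  Ins : Set
  Ins = Cmd A (9 + KK)

  start₁ start₂ next accept finish : ℕ
  start₁ = 25
  start₂ = TrialSize.trialEnd M₁ start₁
  next   = TrialSize.trialEnd M₂ start₂
  accept = 2 + next
  finish = 7 + next

  setPointers : ℕ → Ins
  setPointers 0  = indOneC src
  setPointers 1  = indOneC dst
  setPointers 2  = indOneC cursor
  setPointers 3  = indBrC src last 10 4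
  setPointers 4  = indIncC src
  setPointers 5  = indIncC dst
  setPointers 6  = indIncC dst
  setPointers 7  = indIncC cursor
  setPointers 8  = indIncC cursor
  setPointers 9  = goto 3
  setPointers 10 = indIncC dst
  setPointers 11 = indIncC dst
  setPointers 12 = indIncC dst
  setPointers 13 = indIncC cursor
  setPointers 14 = indIncC cursor
  setPointers 15 = indIncC cursor
  setPointers _  = indOneC src

  copyLoop : ℕ → Ins
  copyLoop 0 = indCopyC dst src
  copyLoop 1 = indBrC src last 23 19
  copyLoop 2 = indIncC src
  copyLoop 3 = indIncC dst
  copyLoop 4 = indIncC dst
  copyLoop 5 = goto 17
  copyLoop 6 = indOneC elem
  copyLoop _ = indOneC budget

  copyInput : ℕ → Ins
  copyInput = setPointers ++[ 17 ] copyLoop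

  afterTrials : ℕ → Ins
  afterTrials 0 = indIncC budget
  afterTrials 1 = goto start₁
  afterTrials 2 = indBrC elem last finish (3 + next)
  afterTrials 3 = indIncC elem
  afterTrials 4 = indIncC cursor
  afterTrials 5 = indIncC cursor
  afterTrials 6 = goto start₁
  afterTrials _ = stopC

  trial₂ trial₁ : ℕ → Ins
  trial₂ = TrialCode.trialCode A KK M₂ g₂ start₂ accept next afterTrials
  trial₁ = TrialCode.trialCode A KK M₁ g₁ start₁ accept start₂ trial₂

  -- Abstract, so that the type checker never unfolds the code of both trials.
  abstract
    code : ℕ → Ins
    code = copyInput ++[ 25 ] trial₁

    open Layout code

    placed₁ : Placed start₁ trial₁
    placed₁ = ++-inr copyInput trial₁ 25

    placed₂ : Placed start₂ trial₂
    placed₂ = TrialPlacement.placed-rest A KK M₁ g₁ start₁ accept start₂ code trial₂ placed₁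

    placed-tail : Placed next afterTrials
    placed-tail = TrialPlacement.placed-rest A KK M₂ g₂ start₂ accept next code afterTrials placed₂

    at-copy : ∀ p {_ : True (p <? 25)} → code p ≡ copyInput p
    at-copy p {p<25} = ++-inl copyInput trial₁ 25 p (toWitness p<25)

    code-beyond : ∀ p → finish ≤ p → code p ≡ stopC
    code-beyond p finish≤p =
      trans (cong code (sym (m∸n+n≡m next≤p))) (trans (placed-tail (p ∸ next)) (beyond (p ∸ next) 7≤p∸next))
      where
      next≤p : next ≤ p
      next≤p = ≤-trans (m≤n+m next 7) finish≤p
      7≤p∸next : 7 ≤ p ∸ next
      7≤p∸next = subst (_≤ p ∸ next) (m+n∸n≡m 7 next) (∸-monoˡ-≤ next finish≤p)
      beyond : ∀ q → 7 ≤ q → afterTrials q ≡ stopC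
      beyond (suc (suc (suc (suc (suc (suc (suc q))))))) (s≤s (s≤s (s≤s (s≤s (s≤s (s≤s (s≤s _))))))) = refl

  N : Program A
  N = program (8 + KK) finish code code-beyond

  open RunReasoning N

  module Trial₁ = TrialRun A KK M₁ g₁ (↑ˡ-injective K₂ _ _) start₁ accept start₂
                           finish code code-beyond trial₂ placed₁
  module Trial₂ = TrialRun A KK M₂ g₂ (↑ʳ-injective K₁ _ _) start₂ accept next
                           finish code code-beyond afterTrials placed₂

  module Input (c₁ c₂ : U A)
               (M₁-spec : ∀ x → Halts M₁ x ⇔ singleton A c₁ x) (M₂-spec : ∀ x → Halts M₂ x ⇔ singleton A c₂ x)
               (X0 : ℕ → U A) (m : ℕ) where

    Good : U A → Set
    Good y = y ≡ c₁ ⊎ y ≡ c₂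

    AllGood : Set
    AllGood = ∀ i → i ≤ m → Good (X0 i)

    Stops₁ Stops₂ : ℕ → ℕ → Set
    Stops₁ e = StopsAfter M₁ (initConfig M₁ (X0 e ∷ []))
    Stops₂ e = StopsAfter M₂ (initConfig M₂ (X0 e ∷ []))

    record Outer (d : StateOf N) (e bud : ℕ) : Set where
      constructor outer
      field
        at-start    : pc d ≡ start₁
        counted     : Counters (Ir d) m e bud
        copied      : InputCopied (Zr d) m X0
        e≤m         : e ≤ m
        good-before : ∀ i → i < e → Good (X0 i)

    RoundResult : ℕ → ℕ → StateOf N → Set
    RoundResult e bud d = Outer d (suc e) bud
                        ⊎ (Stopped N d × AllGood)
                        ⊎ (Outer d e (suc bud) × ¬ Stops₁ e bud × ¬ Stops₂ e bud)

    accepted : ∀ {Zs Is e bud} → Counters Is m e bud → InputCopied Zs m X0 → e ≤ m →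
               (∀ i → i < e → Good (X0 i)) → Good (X0 e) →
               Reach N (exec N ⟨ accept , Zs , Is ⟩) (RoundResult e bud)
    accepted {Zs} {Is} {e} {bud} (last≡ , elem≡ , cursor≡ , budget≡) copied e≤m before good with e ≟ m
    ... | yes refl =
      after-if-≡ (placed-tail 2) (trans elem≡ (sym last≡)) (reach-here (inj₂ (inj₁ (placed-tail 7 , all-good))))
      where
      all-good : AllGood
      all-good i i≤e with m≤n⇒m<n∨m≡n i≤e
      ... | inj₁ i<e = before i i<e
      ... | inj₂ refl = good
    ... | no e≢m = after-if-≢ (placed-tail 2) (λ eq → e≢m (trans (sym elem≡) (trans eq last≡)))
      (reach-cmd (placed-tail 3) (reach-cmd (placed-tail 4) (reach-cmd (placed-tail 5) (reach-goto (placed-tail 6)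
        (reach-here (inj₁ (outer refl (last≡ , cong suc elem≡ , cong (λ n → suc (suc n)) cursor≡ , budget≡)
                                 copied (≤∧≢⇒< e≤m e≢m) before')))))))
      where
      before' : ∀ i → i < suc e → Good (X0 i)
      before' i i<1+e with m≤n⇒m<n∨m≡n (≤-pred i<1+e)
      ... | inj₁ i<e = before i i<e
      ... | inj₂ refl = good

    timed-out : ∀ {Zs Is e bud} → Counters Is m e bud → InputCopied Zs m X0 → e ≤ m →
                (∀ i → i < e → Good (X0 i)) → ¬ Stops₁ e bud → ¬ Stops₂ e bud →
                Reach N (exec N ⟨ next , Zs , Is ⟩) (RoundResult e bud)
    timed-out (last≡ , elem≡ , cursor≡ , budget≡) copied e≤m before ¬stops₁ ¬stops₂ =
      after-cmd (placed-tail 0) (reach-goto (placed-tail 1)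
        (reach-here (inj₂ (inj₂ (outer refl (last≡ , elem≡ , cursor≡ , cong suc budget≡) copied e≤m before
                                , ¬stops₁ , ¬stops₂)))))

    good₁ : ∀ {e t} → Stops₁ e t → Good (X0 e)
    good₁ {e} {t} stops = inj₁ (cong head (Equivalence.to (M₁-spec (X0 e ∷ [])) (t , stops)))

    good₂ : ∀ {e t} → Stops₂ e t → Good (X0 e)
    good₂ {e} {t} stops = inj₂ (cong head (Equivalence.to (M₂-spec (X0 e ∷ [])) (t , stops)))

    round : ∀ {d e bud} → Outer d e bud → Reach N (exec N d) (RoundResult e bud)
    round {⟨ _ , Zs , Is ⟩} {e} {bud} (outer refl counted copied e≤m before) =
      reach-bind⁺ (Trial₁.Attempt.trial X0 m e bud e≤m Zs Is counted copied) after₁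
      where
      after₂ : ¬ Stops₁ e bud → ∀ d → Trial₂.Attempt.Outcome X0 m e bud e≤m d →
               Reach N (exec N d) (RoundResult e bud)
      after₂ _ ⟨ _ , _ , _ ⟩ (counted , copied , inj₁ (refl , stops₂)) =
        accepted counted copied e≤m before (good₂ {t = bud} stops₂)
      after₂ ¬stops₁ ⟨ _ , _ , _ ⟩ (counted , copied , inj₂ (refl , ¬stops₂)) =
        timed-out counted copied e≤m before ¬stops₁ ¬stops₂
      after₁ : ∀ d → Trial₁.Attempt.Outcome X0 m e bud e≤m d → Reach N (exec N d) (RoundResult e bud)
      after₁ ⟨ _ , _ , _ ⟩ (counted , copied , inj₁ (refl , stops₁)) =
        accepted counted copied e≤m before (good₁ {t = bud} stops₁)
      after₁ ⟨ _ , Zs , Is ⟩ (counted , copied , inj₂ (refl , ¬stops₁)) =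
        reach-bind⁺ (Trial₂.Attempt.trial X0 m e bud e≤m Zs Is counted copied) (after₂ ¬stops₁)

    outer-not-stopped : ∀ {d e bud} → Outer d e bud → ¬ Stopped N d
    outer-not-stopped (outer refl _ _ _ _) stop with trans (sym (placed₁ 0)) stop
    ... | ()

    sound : ∀ f {d e bud} → Outer d e bud → (h : HaltsFrom N d) → Reach.steps h < f → AllGood
    sound (suc f) o (reach zero stop) _ = ⊥-elim (outer-not-stopped o stop)
    sound (suc f) {d} {e} {bud} o (reach (suc t) stop) (s≤s t<f) with round o
    ... | reach k result = continue result
      where
      later : HaltsFrom N (execute N k (exec N d))
      later = reach (t ∸ k) (stopped-later t k (exec N d) stop)
      continue : RoundResult e bud (execute N k (exec N d)) → AllGood
      continue (inj₁ o')                 = sound f o' later (≤-<-trans (m∸n≤m t k) t<f)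
      continue (inj₂ (inj₁ (_ , all)))   = all
      continue (inj₂ (inj₂ (o' , _ , _))) = sound f o' later (≤-<-trans (m∸n≤m t k) t<f)

    stops-on-good : ∀ e → Good (X0 e) → Σ ℕ λ t → Stops₁ e t ⊎ Stops₂ e t
    stops-on-good e (inj₁ refl) with Equivalence.from (M₁-spec (X0 e ∷ [])) refl
    ... | t , stops = t , inj₁ stops
    stops-on-good e (inj₂ refl) with Equivalence.from (M₂-spec (X0 e ∷ [])) refl
    ... | t , stops = t , inj₂ stops

    complete : AllGood → ∀ r {d e bud} → r + e ≡ m → Outer d e bud → HaltsFrom N d
    complete all r {d} {e} {bud} r+e≡m o = retry (proj₁ witness) (m≤m+n _ bud) o
      where
      witness = stops-on-good e (all e (Outer.e≤m o))
      t₀ = proj₁ witness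
      next-element : ∀ r → r + e ≡ m → ∀ {d' bud'} → Outer d' (suc e) bud' → HaltsFrom N d'
      next-element zero    refl o' = ⊥-elim (<⇒≱ (Outer.e≤m o') ≤-refl)
      next-element (suc r) r+e≡m o' = complete all r (trans (+-suc r e) r+e≡m) o'
      retry : ∀ f {d bud} → t₀ ≤ f + bud → Outer d e bud → HaltsFrom N d
      retry f {d} {bud} t₀≤f+bud o with round o
      ... | reach k (inj₁ o') = halts-later (suc k) (next-element r r+e≡m o')
      ... | reach k (inj₂ (inj₁ (stop , _))) = halts-later (suc k) (reach 0 stop)
      ... | reach k (inj₂ (inj₂ (o' , ¬stops₁ , ¬stops₂))) with f | proj₂ witness
      ...   | suc f | _          = halts-later (suc k) (retry f (subst (t₀ ≤_) (sym (+-suc f bud)) t₀≤f+bud) o')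
      ...   | zero  | inj₁ stops = ⊥-elim (¬stops₁ (stopsAfter-mono M₁ _ t₀≤f+bud stops))
      ...   | zero  | inj₂ stops = ⊥-elim (¬stops₂ (stopsAfter-mono M₂ _ t₀≤f+bud stops))

    PointersSet : (ℕ → U A) → StateOf N → Set
    PointersSet Zs d =
      pc d ≡ 10 × Zr d ≡ Zs × Ir d dst ≡ double m × Ir d cursor ≡ double m × Ir d last ≡ m

    InputSaved : StateOf N → Set
    InputSaved d = pc d ≡ 23 × InputCopied (Zr d) m X0 × Ir d last ≡ m × Ir d cursor ≡ inputCell m 0

    pointer-loop : ∀ r p Zs Is → r + p ≡ m → Is src ≡ p → Is dst ≡ double p → Is cursor ≡ double p →
                   Is last ≡ m →
      Reach N ⟨ 3 , Zs , Is ⟩ (PointersSet Zs)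
    pointer-loop zero    p Zs Is refl src≡ dst≡ cursor≡ last≡ =
      reach-if-≡ (at-copy 3) (trans src≡ (sym last≡)) (reach-here (refl , refl , dst≡ , cursor≡ , last≡))
    pointer-loop (suc r) p Zs Is r+p≡m src≡ dst≡ cursor≡ last≡ =
      reach-if-≢ (at-copy 3) src≢last (reach-cmd (at-copy 4) (reach-cmd (at-copy 5) (reach-cmd (at-copy 6)
        (reach-cmd (at-copy 7) (reach-cmd (at-copy 8) (reach-goto (at-copy 9)
          (pointer-loop r (suc p) Zs _ (trans (+-suc r p) r+p≡m) (cong suc src≡)
            (cong (λ n → suc (suc n)) dst≡) (cong (λ n → suc (suc n)) cursor≡) last≡)))))))
      where
      src≢last : Is src ≢ Is last
      src≢last eq = <⇒≢ (subst (p <_) r+p≡m (m<n+m p (s≤s z≤n))) (trans (sym src≡) (trans eq last≡))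

    copy-loop : ∀ r p Zs Is → r + p ≡ m → Is src ≡ p → Is dst ≡ inputCell m p → Is last ≡ m →
                Is cursor ≡ inputCell m 0 →
      (∀ i → i < p → Zs (inputCell m i) ≡ X0 i) → (∀ j → j ≤ m → Zs j ≡ X0 j) →
      Reach N ⟨ 17 , Zs , Is ⟩ InputSaved
    copy-loop r p Zs Is r+p≡m src≡ dst≡ last≡ cursor≡ done input =
      reach-cmd (at-copy 17) (subst (λ Zs → Reach N ⟨ 18 , Zs , Is ⟩ InputSaved) (sym written) (continue r r+p≡m))
      where
      Zs' : ℕ → U A
      Zs' = updZ Zs (inputCell m p) (Zs p)
      written : updZ Zs (Is dst) (Zs (Is src)) ≡ Zs'
      written rewrite dst≡ | src≡ = refl
      p≤m : p ≤ m
      p≤m = subst (p ≤_) r+p≡m (m≤n+m p r)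
      done' : ∀ i → i < suc p → Zs' (inputCell m i) ≡ X0 i
      done' i i<1+p with m≤n⇒m<n∨m≡n (≤-pred i<1+p)
      ... | inj₁ i<p = trans (updZ-other Zs _ (Zs p) (inputCell m i) (<⇒≢ i<p ∘ inputCell-injective m)) (done i i<p)
      ... | inj₂ refl = trans (updZ-same Zs (inputCell m i) (Zs i)) (input i p≤m)
      input' : ∀ j → j ≤ m → Zs' j ≡ X0 j
      input' j j≤m = trans (updZ-other Zs (inputCell m p) (Zs p) j (input≢inputCell m p j≤m)) (input j j≤m)
      continue : ∀ r → r + p ≡ m → Reach N ⟨ 18 , Zs' , Is ⟩ InputSaved
      continue zero    refl = reach-if-≡ (at-copy 18) (trans src≡ (sym last≡))
                                (reach-here (refl , (λ i i≤p → done' i (s≤s i≤p)) , last≡ , cursor≡))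
      continue (suc r) r+p≡m =
        reach-if-≢ (at-copy 18) (λ eq → <⇒≢ p<m (trans (sym src≡) (trans eq last≡)))
          (reach-cmd (at-copy 19) (reach-cmd (at-copy 20) (reach-cmd (at-copy 21) (reach-goto (at-copy 22)
            (copy-loop r (suc p) Zs' _ (trans (+-suc r p) r+p≡m) (cong suc src≡) (cong (λ n → suc (suc n)) dst≡)
              last≡ cursor≡ done' input')))))
        where
        p<m : p < m
        p<m = subst (p <_) r+p≡m (m<n+m p (s≤s z≤n))

    copy-input-phase : Reach N ⟨ 0 , X0 , initI (suc m) ⟩ (λ d → Outer d 0 0)
    copy-input-phase =
      reach-cmd (at-copy 0) (reach-cmd (at-copy 1) (reach-cmd (at-copy 2)
        (reach-bind (pointer-loop m 0 X0 _ (+-identityʳ m) refl refl refl refl) after-pointers)))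
      where
      after-copy : ∀ d → InputSaved d → Reach N d (λ d → Outer d 0 0)
      after-copy ⟨ _ , Zs , Is ⟩ (refl , copied , last≡ , cursor≡) =
        reach-cmd (at-copy 23) (reach-cmd (at-copy 24)
          (reach-here (outer refl (last≡ , refl , cursor≡ , refl) copied z≤n (λ _ ()))))
      after-pointers : ∀ d → PointersSet X0 d → Reach N d (λ d → Outer d 0 0)
      after-pointers ⟨ _ , _ , Is ⟩ (refl , refl , dst≡ , cursor≡ , last≡) =
        reach-cmd (at-copy 10) (reach-cmd (at-copy 11) (reach-cmd (at-copy 12) (reach-cmd (at-copy 13)
          (reach-cmd (at-copy 14) (reach-cmd (at-copy 15) (reach-cmd (at-copy 16)
            (reach-bind (copy-loop m 0 X0 _ (+-identityʳ m) refl (cong (3 +_) dst≡) last≡ (cong (3 +_) cursor≡)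
                          (λ _ ()) (λ _ _ → refl)) after-copy)))))))

All⇒initZ : {X : Set} {P : X → Set} (a : X) (as : List X) → All P (a ∷ as) →
            ∀ i → i ≤ length as → P (initZ (a ∷ as) i)
All⇒initZ a []       (pa ∷ [])  i       _         = pa
All⇒initZ a (b ∷ bs) (pa ∷ _)   zero    _         = pa
All⇒initZ a (b ∷ bs) (_ ∷ pbs) (suc i) (s≤s i≤n) = All⇒initZ b bs pbs i i≤n

initZ⇒All : {X : Set} {P : X → Set} (a : X) (as : List X) → (∀ i → i ≤ length as → P (initZ (a ∷ as) i)) →
            All P (a ∷ as)
initZ⇒All a []       p = p 0 z≤n ∷ []
initZ⇒All a (b ∷ bs) p = p 0 z≤n ∷ initZ⇒All b bs (λ i i≤n → p (suc i) (s≤s i≤n))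

pairStar-sdec : {A : Structure} (c₁ c₂ : U A) →
                SDEC A (singleton A c₁) × SDEC A (singleton A c₂) → SDEC A (pairStar A c₁ c₂)
pairStar-sdec {A} c₁ c₂ ((M₁ , M₁-spec) , (M₂ , M₂-spec)) =
  compile N , λ xs → ⇔-trans (compile-halts N xs) (accepts xs)
  where
  open PairStar A M₁ M₂
  open RunReasoning N
  accepts : ∀ xs → Accepts N xs ⇔ pairStar A c₁ c₂ xs
  accepts (a ∷ as) = mk⇔ to from
    where
    open Input c₁ c₂ M₁-spec M₂-spec (initZ (a ∷ as)) (length as)
    to : Accepts N (a ∷ as) → pairStar A c₁ c₂ (a ∷ as)
    to halts with copy-input-phase
    ... | reach k o = initZ⇒All a as (sound _ o (halts-earlier k halts) ≤-refl)
    from : pairStar A c₁ c₂ (a ∷ as) → Accepts N (a ∷ as)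
    from all with copy-input-phase
    ... | reach k o = halts-later k (complete (All⇒initZ a as all) (length as) (+-identityʳ _) o)

proposition6p7 : (A : Structure) (i₁ i₂ : Fin (nConst A)) → const A i₁ ≢ const A i₂ →
    (HasIdRelation A → DEC A (idSet A))
    × (DEC A (idSet A) → SDEC A (idSet A))
    × (SDEC A (idSet A) → SDEC A (singleton A (const A i₁)) × SDEC A (singleton A (const A i₂)))
    × (SDEC A (singleton A (const A i₁)) × SDEC A (singleton A (const A i₂)) → SDEC A (pairStar A (const A i₁) (const A i₂)))
-- None of the constructions compares c₁ with c₂.
proposition6p7 A i₁ i₂ _ =
    idSet-dec
  , proj₁
  , (λ id-sdec → singleton-sdec i₁ id-sdec , singleton-sdec i₂ id-sdec)
  , pairStar-sdec (const A i₁) (const A i₂)
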